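{- For every integer $n\ge1$, $\mathrm{pk}_n(123,132)=\frac1{\sqrt5}\left(\frac{3+\sqrt5}2\right)^n-\frac1{\sqrt5}\left(\frac{3-\sqrt5}2\right)^n$.
   Context: For a positive integer $n$, $[n]=\{1,\dots,n\}$. A function $f:[n]\to[n]$ is a parking function if for every $i\in[n]$, $|\{j\in[n]: f(j)\le i\}|\ge i$ (equivalently, in the usual car-parking process where car $i$ prefers spot $f(i)$ and takes the first free spot at or after it, all cars park). The parking permutation $\rho_f\in S_n$ is defined by: spot $i$ is occupied by car $\rho_f(i)$. A permutation $\pi\in S_n$ contains $\sigma\in S_m$ as a pattern if there exist $1\le i_1<\dots<i_m\le n$ with $\pi(i_a)<\pi(i_b)$ iff $\sigma(a)<\sigma(b)$ for all $a,b$; otherwise it avoids $\sigma$. $\mathrm{pk}_n(\sigma_1,\dots,\sigma_k)$ is the number of parking functions $f:[n]\to[n]$ with $\rho_f$ avoiding every $\sigma_i$. -}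

module Defs where

open import Data.Bool using (Bool; true; false; _∧_; not; if_then_else_)
open import Data.Nat using (ℕ; zero; suc; _≤ᵇ_; _<ᵇ_; _≡ᵇ_; _≥_)
open import Data.List using (List; []; _∷_; length; map; filterᵇ; upTo; concatMap; zip; _++_)
open import Data.Bool.ListAction using (all; any)
open import Data.Maybe using (Maybe; just; nothing)
open import Data.Product using (_×_; _,_)
open import Data.Integer using (+_)
open import Data.Rational using (ℚ; 0ℚ; 1ℚ; ½; _/_) renaming (_+_ to _+ℚ_; _*_ to _*ℚ_; _-_ to _-ℚ_)

-- Everything is 1-indexed, as in the paper.
-- A function f : [n] → [n] is represented by the list (f 1, …, f n);
-- a permutation π ∈ S_n by its one-line notation (π 1, …, π n).

range : ℕ → List ℕ
range n = map suc (upTo n)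

allFns : ℕ → ℕ → List (List ℕ)
allFns zero    n = [] ∷ []
allFns (suc k) n = concatMap (λ v → map (v ∷_) (allFns k n)) (range n)

count : {A : Set} → (A → Bool) → List A → ℕ
count p xs = length (filterᵇ p xs)

isParking : ℕ → List ℕ → Bool
isParking n f = all (λ i → i ≤ᵇ count (λ v → v ≤ᵇ i) f) (range n)

-- Parking process.  The street is a list of n spots (spot 1 first);
-- `nothing` = free, `just c` = occupied by car c.
emptyStreet : ℕ → List (Maybe ℕ)
emptyStreet zero    = []
emptyStreet (suc n) = nothing ∷ emptyStreet n

-- car c (preferring spot p) takes the first free spot at or after p;
-- the current spot index is s.
parkCar : ℕ → ℕ → ℕ → List (Maybe ℕ) → List (Maybe ℕ)
parkCar c p s []              = []
parkCar c p s (just d  ∷ st)  = just d ∷ parkCar c p (suc s) st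
parkCar c p s (nothing ∷ st)  =
  if p ≤ᵇ s then just c ∷ st else nothing ∷ parkCar c p (suc s) st

parkAll : ℕ → List ℕ → List (Maybe ℕ) → List (Maybe ℕ)
parkAll c []       st = st
parkAll c (p ∷ ps) st = parkAll (suc c) ps (parkCar c p 1 st)

fromSpot : Maybe ℕ → ℕ
fromSpot (just c) = c
fromSpot nothing  = 0   -- never happens for parking functions

parkingPerm : ℕ → List ℕ → List ℕ
parkingPerm n f = map fromSpot (parkAll 1 f (emptyStreet n))

subseqs : ℕ → List ℕ → List (List ℕ)
subseqs zero    xs       = [] ∷ []
subseqs (suc m) []       = []
subseqs (suc m) (x ∷ xs) = map (x ∷_) (subseqs m xs) ++ subseqs (suc m) xs

_==_ : Bool → Bool → Bool
true  == b = b
false == b = not b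

orderIso : List ℕ → List ℕ → Bool
orderIso xs σ =
  all (λ { (x , s) → all (λ { (y , t) → (x <ᵇ y) == (s <ᵇ t) }) ps }) ps
  where ps = zip xs σ

contains : List ℕ → List ℕ → Bool
contains π σ = any (λ ys → orderIso ys σ) (subseqs (length σ) π)

avoids : List ℕ → List ℕ → Bool
avoids π σ = not (contains π σ)

pk : ℕ → List (List ℕ) → ℕ
pk n σs = count (λ f → isParking n f ∧ all (avoids (parkingPerm n f)) σs) (allFns n n)

-- Exact arithmetic in ℚ(√5): a + b√5 represented as (a , b).

Q5 : Set
Q5 = ℚ × ℚ

_⊕_ : Q5 → Q5 → Q5
(a , b) ⊕ (c , d) = (a +ℚ c , b +ℚ d)

_⊖_ : Q5 → Q5 → Q5
(a , b) ⊖ (c , d) = (a -ℚ c , b -ℚ d)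

_⊗_ : Q5 → Q5 → Q5
(a , b) ⊗ (c , d) = (a *ℚ c +ℚ (+ 5 / 1) *ℚ (b *ℚ d) , a *ℚ d +ℚ b *ℚ c)

_^5_ : Q5 → ℕ → Q5
x ^5 zero  = (1ℚ , 0ℚ)
x ^5 suc k = x ⊗ (x ^5 k)

embedℕ : ℕ → Q5
embedℕ m = (+ m / 1 , 0ℚ)

-- 1/√5 = (1/5)√5
invSqrt5 : Q5
invSqrt5 = (0ℚ , + 1 / 5)

φ² : Q5
φ² = (+ 3 / 2 , ½)

ψ² : Q5
ψ² = (+ 3 / 2 , 0ℚ -ℚ ½)

p123 p132 : List ℕ
p123 = 1 ∷ 2 ∷ 3 ∷ []
p132 = 1 ∷ 3 ∷ 2 ∷ []

-- Let the last car n stand at spot j + 1 of the parking permutation ρ. Avoiding 132 forces the j cars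
-- in front of it to exceed all cars behind it, and avoiding 123 forces them to decrease, so
-- ρ = (r + j, …, r + 1, n, ρ′) with j + r = n − 1 and ρ′ ∈ S_r again avoiding both. Running the parking
-- process backwards, cars 1, …, r form such a parking function g on [r] shifted behind j + 1 free
-- spots, cars r + 1, …, r + j prefer spots j, …, 1 and car n prefers some p ≤ j + 1; conversely every
-- such (j, p, g) gives one. Hence a_n = pk_n(123,132) satisfies a_0 = 1 and
-- a_{m+1} = Σ_{j+r=m} (j + 1) a_r, so a_{m+2} = 2 a_{m+1} + (a_0 + … + a_m): the recurrence of F_{2n}.

module Submission where

open import Defs
open import Data.Nat using (ℕ; _≥_)
open import Data.List using (List; []; _∷_)
open import Relation.Binary.PropositionalEquality using (_≡_)

open import Data.Bool using (Bool; true; false; _∧_; not; T)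
open import Data.Bool.ListAction using (all)
open import Data.Bool.Properties using (T-≡; T-∧)
import Data.Integer as ℤ
open import Data.List using (length; map; filterᵇ; take; drop; upTo; initLast; _∷ʳ′_; concatMap; catMaybes; zip; _++_; [_])
open import Data.List.Membership.Propositional using (_∈_; find; lose)
open import Data.List.Membership.Propositional.Properties
  using (∈-++⁺ˡ; ∈-++⁺ʳ; ∈-++⁻; ∈-map⁺; ∈-map⁻; ∈-upTo⁺; ∈-upTo⁻; ∈-concatMap⁺; ∈-concatMap⁻; ∈-∃++; ∈-filter⁺; ∈-filter⁻)
open import Data.List.Properties
  using (length-++; length-++-sucʳ; length-map; length-take; length-drop; length-upTo; length-catMaybes; map-++; map-∘; map-id;
         map-injective; ++-assoc; ++-cancelʳ; ∷-injective; ∷ʳ-injective; catMaybes-++; filter-accept; filter-reject; filter-++;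
         take++drop≡id)
open import Data.List.Relation.Binary.Disjoint.Propositional using (Disjoint)
open import Data.List.Relation.Binary.Pointwise as Pointwise using (Pointwise; []; _∷_)
open import Data.List.Relation.Binary.Sublist.Propositional using (_⊆_; []; _∷_; _∷ʳ_; minimum; from∈)
open import Data.List.Relation.Binary.Sublist.Propositional.Properties using (++⁺; ++⁺ˡ; All-resp-⊆)
open import Data.List.Relation.Unary.All as All using (All; []; _∷_)
import Data.List.Relation.Unary.All.Properties as All
open import Data.List.Relation.Unary.AllPairs as AllPairs using (AllPairs; []; _∷_)
import Data.List.Relation.Unary.AllPairs.Properties as AllPairs
open import Data.List.Relation.Unary.Any using (here; there)
open import Data.List.Relation.Unary.Any.Properties using (any⁺; any⁻)
open import Data.List.Relation.Unary.Unique.Propositional using (Unique)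
import Data.List.Relation.Unary.Unique.Propositional.Properties as Unique
open import Data.Maybe using (Maybe; just; nothing)
open import Data.Nat using (zero; suc; _+_; _*_; _∸_; _⊓_; _≤_; _<_; _>_; _≤ᵇ_; _<ᵇ_; z≤n; s≤s)
open import Data.Nat.Divisibility using (∣1⇒≡1)
open import Data.Nat.Induction using (<-rec)
open import Data.Nat.Properties
open import Data.Nat.Solver using (module +-*-Solver)
open import Data.Product using (_×_; _,_; proj₁; proj₂; ∃; ∃₂; uncurry)
open import Data.Rational using (ℚ; ½; _/_; 0ℚ; mkℚ) renaming (_+_ to _+ℚ_; _*_ to _*ℚ_; _-_ to _-ℚ_)
import Data.Rational.Properties as ℚₚ
import Data.Rational.Solver as ℚ-Solver
open import Data.Sum using (_⊎_; inj₁; inj₂; [_,_]′)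
open import Data.Unit using (tt)
open import Function using (Equivalence; _∘_)
open import Relation.Binary using (tri<; tri≈; tri>)
open import Relation.Binary.PropositionalEquality
  using (refl; sym; trans; cong; cong₂; subst; subst₂; _≢_; ≢-sym; module ≡-Reasoning)
open import Relation.Nullary using (¬_; contradiction; yes; no)
open import Relation.Nullary.Decidable using (T?)

≤ᵇ-true : ∀ {m n} → m ≤ n → (m ≤ᵇ n) ≡ true
≤ᵇ-true m≤n = Equivalence.to T-≡ (≤⇒≤ᵇ m≤n)

≤ᵇ-false : ∀ {m n} → n < m → (m ≤ᵇ n) ≡ false
≤ᵇ-false {m} {n} n<m with m ≤ᵇ n in eq
... | false = refl
... | true  = contradiction (≤ᵇ⇒≤ m n (subst T (sym eq) tt)) (<⇒≱ n<m)

<ᵇ-true : ∀ {m n} → m < n → (m <ᵇ n) ≡ true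
<ᵇ-true m<n = Equivalence.to T-≡ (<⇒<ᵇ m<n)

<ᵇ-false : ∀ {m n} → n ≤ m → (m <ᵇ n) ≡ false
<ᵇ-false {m} {n} n≤m with m <ᵇ n in eq
... | false = refl
... | true  = contradiction (<ᵇ⇒< m n (subst T (sym eq) tt)) (≤⇒≯ n≤m)

suc-≤ᵇ-suc : ∀ m n → (suc m ≤ᵇ suc n) ≡ (m ≤ᵇ n)
suc-≤ᵇ-suc zero    n = refl
suc-≤ᵇ-suc (suc m) n = refl

+-≤ᵇ-+ : ∀ k p s → (k + p ≤ᵇ k + s) ≡ (p ≤ᵇ s)
+-≤ᵇ-+ zero    p s = refl
+-≤ᵇ-+ (suc k) p s = trans (suc-≤ᵇ-suc (k + p) (k + s)) (+-≤ᵇ-+ k p s)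

T-not⁻ : ∀ b → T (not b) → ¬ T b
T-not⁻ false _  ()
T-not⁻ true  () _

T-not⁺ : ∀ b → ¬ T b → T (not b)
T-not⁺ false _  = tt
T-not⁺ true  ¬t = ¬t tt

count-accept : ∀ {A : Set} (p : A → Bool) x xs → T (p x) → count p (x ∷ xs) ≡ suc (count p xs)
count-accept p x xs px = cong length (filter-accept (T? ∘ p) px)

count-reject : ∀ {A : Set} (p : A → Bool) x xs → ¬ T (p x) → count p (x ∷ xs) ≡ count p xs
count-reject p x xs ¬px = cong length (filter-reject (T? ∘ p) ¬px)

count-++ : ∀ {A : Set} (p : A → Bool) xs ys → count p (xs ++ ys) ≡ count p xs + count p ys
count-++ p xs ys = trans (cong length (filter-++ (T? ∘ p) xs ys)) (length-++ (filterᵇ p xs))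

++-injective : ∀ {A : Set} (xs xs′ : List A) {ys ys′} → length xs ≡ length xs′ →
  xs ++ ys ≡ xs′ ++ ys′ → xs ≡ xs′ × ys ≡ ys′
++-injective []       []         _   e = refl , e
++-injective (x ∷ xs) (x′ ∷ xs′) len e with ∷-injective e
... | refl , e′ with ++-injective xs xs′ (suc-injective len) e′
...   | refl , e″ = refl , e″

length-∷ʳ : ∀ {A : Set} (xs : List A) x → length (xs ++ [ x ]) ≡ suc (length xs)
length-∷ʳ xs x = trans (length-++ xs) (+-comm (length xs) 1)

All-insert : ∀ {P : ℕ → Set} xs {ys c} → All P (xs ++ ys) → P c → All P (xs ++ c ∷ ys)
All-insert xs Pxs++ys Pc = All.++⁺ (All.++⁻ˡ xs Pxs++ys) (Pc ∷ All.++⁻ʳ xs Pxs++ys)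

Unique-insert : ∀ xs {ys c} → Unique (xs ++ ys) → All (_≢ c) (xs ++ ys) → Unique (xs ++ c ∷ ys)
Unique-insert []       u          ≢c         = All.map ≢-sym ≢c ∷ u
Unique-insert (x ∷ xs) (x∉ ∷ u) (x≢c ∷ ≢c) = All-insert xs x∉ x≢c ∷ Unique-insert xs u ≢c

Street : Set
Street = List (Maybe ℕ)

data _≼_ : Maybe ℕ → Maybe ℕ → Set where
  free  : ∀ {x} → nothing ≼ x
  taken : ∀ {c} → just c ≼ just c

_⊑_ : Street → Street → Set
_⊑_ = Pointwise _≼_

≼-refl : ∀ {x} → x ≼ x
≼-refl {nothing} = free
≼-refl {just _}  = taken

≼-trans : ∀ {x y z} → x ≼ y → y ≼ z → x ≼ z
≼-trans free  _     = free
≼-trans taken taken = taken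

⊑-refl : ∀ {st} → st ⊑ st
⊑-refl = Pointwise.refl ≼-refl

⊑-trans : ∀ {st st′ st″} → st ⊑ st′ → st′ ⊑ st″ → st ⊑ st″
⊑-trans = Pointwise.transitive ≼-trans

⊑-splitʳ : ∀ A′ {B′ st} → st ⊑ (A′ ++ B′) → ∃₂ λ A B → st ≡ A ++ B × A ⊑ A′ × B ⊑ B′
⊑-splitʳ []       {st = st} st⊑B′ = [] , st , refl , [] , st⊑B′
⊑-splitʳ (_ ∷ A′) (_∷_ {x = x} x≼y st⊑A′++B′) with ⊑-splitʳ A′ st⊑A′++B′
... | A , B , refl , A⊑A′ , B⊑B′ = x ∷ A , B , refl , x≼y ∷ A⊑A′ , B⊑B′

length-catMaybes-⊑ : ∀ {st st′} → st ⊑ st′ → length (catMaybes st) ≤ length (catMaybes st′)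
length-catMaybes-⊑ []                        = z≤n
length-catMaybes-⊑ (free {x = nothing} ∷ p) = length-catMaybes-⊑ p
length-catMaybes-⊑ (free {x = just _} ∷ p)  = m≤n⇒m≤1+n (length-catMaybes-⊑ p)
length-catMaybes-⊑ (taken ∷ p)              = s≤s (length-catMaybes-⊑ p)

∈-catMaybes-⊑ : ∀ {st st′ c} → st ⊑ st′ → c ∈ catMaybes st → c ∈ catMaybes st′
∈-catMaybes-⊑ (free {x = nothing} ∷ p) c∈st = ∈-catMaybes-⊑ p c∈st
∈-catMaybes-⊑ (free {x = just _} ∷ p)  c∈st = there (∈-catMaybes-⊑ p c∈st)
∈-catMaybes-⊑ (taken ∷ p) (here refl)       = here refl
∈-catMaybes-⊑ (taken ∷ p) (there c∈st)      = there (∈-catMaybes-⊑ p c∈st)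

catMaybes-map-just : ∀ (xs : List ℕ) → catMaybes (map just xs) ≡ xs
catMaybes-map-just []       = refl
catMaybes-map-just (x ∷ xs) = cong (x ∷_) (catMaybes-map-just xs)

catMaybes-map-just-++ : ∀ xs (R : Street) → catMaybes (map just xs ++ R) ≡ xs ++ catMaybes R
catMaybes-map-just-++ []       R = refl
catMaybes-map-just-++ (x ∷ xs) R = cong (x ∷_) (catMaybes-map-just-++ xs R)

length-emptyStreet : ∀ n → length (emptyStreet n) ≡ n
length-emptyStreet zero    = refl
length-emptyStreet (suc n) = cong suc (length-emptyStreet n)

catMaybes-emptyStreet : ∀ n → catMaybes (emptyStreet n) ≡ []
catMaybes-emptyStreet zero    = refl
catMaybes-emptyStreet (suc n) = catMaybes-emptyStreet n

catMaybes-emptyStreet-++ : ∀ n R → catMaybes (emptyStreet n ++ R) ≡ catMaybes R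
catMaybes-emptyStreet-++ zero    R = refl
catMaybes-emptyStreet-++ (suc n) R = catMaybes-emptyStreet-++ n R

emptyStreet-+ : ∀ a b → emptyStreet (a + b) ≡ emptyStreet a ++ emptyStreet b
emptyStreet-+ zero    b = refl
emptyStreet-+ (suc a) b = cong (nothing ∷_) (emptyStreet-+ a b)

emptyStreet-∷ʳ : ∀ j X → emptyStreet j ++ nothing ∷ X ≡ emptyStreet (suc j) ++ X
emptyStreet-∷ʳ zero    X = refl
emptyStreet-∷ʳ (suc j) X = cong (nothing ∷_) (emptyStreet-∷ʳ j X)

⊑-just-in : ∀ X {Z c} L {W} → (X ++ just c ∷ Z) ⊑ (map just L ++ W) → length X < length L → c ∈ L
⊑-just-in []      (l ∷ L) (taken ∷ _)  _         = here refl
⊑-just-in (_ ∷ X) (l ∷ L) (_ ∷ X⊑L)  (s≤s X<L) = there (⊑-just-in X L X⊑L X<L)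

⊑-just-emptyStreet : ∀ X {Z c} m {W} → ¬ ((X ++ just c ∷ Z) ⊑ (emptyStreet m ++ W) × length X < m)
⊑-just-emptyStreet []      (suc m) (() ∷ _ , _)
⊑-just-emptyStreet (_ ∷ X) (suc m) (_ ∷ X⊑ , s≤s X<m) = ⊑-just-emptyStreet X m (X⊑ , X<m)

⊑-free : ∀ X X′ {Y Y′ st} → (X ++ nothing ∷ Y) ⊑ st → st ⊑ (X′ ++ nothing ∷ Y′) → length X ≡ length X′ →
  ∃₂ λ X₁ Y₁ → st ≡ X₁ ++ nothing ∷ Y₁ × X ⊑ X₁ × length X₁ ≡ length X
⊑-free []      []       {st = _ ∷ st} (_ ∷ _)      (free ∷ _) _   = [] , st , refl , [] , refl
⊑-free (_ ∷ X) (_ ∷ X′) {st = s ∷ st} (x≼s ∷ X⊑) (_ ∷ ⊑X′) len with ⊑-free X X′ X⊑ ⊑X′ (suc-injective len)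
... | X₁ , Y₁ , refl , X⊑X₁ , lenX₁ = s ∷ X₁ , Y₁ , refl , x≼s ∷ X⊑X₁ , cong suc lenX₁

⊑-above-free : ∀ {r} L {st R} → st ⊑ (map just L ++ nothing ∷ R) → All (r <_) L → All (_≤ r) (catMaybes st) →
  ∃ λ B → st ≡ emptyStreet (length L) ++ nothing ∷ B
⊑-above-free []      {st = _ ∷ B}       (free ∷ _)   _          _          = B , refl
⊑-above-free (_ ∷ L) {st = nothing ∷ _} (free ∷ st⊑) (_ ∷ r<L)  ≤r         with ⊑-above-free L st⊑ r<L ≤r
... | B , refl = B , refl
⊑-above-free (_ ∷ L) {st = just _ ∷ _}  (taken ∷ _)  (r<v ∷ _) (v≤r ∷ _) = contradiction v≤r (<⇒≱ r<v)

-- The parking process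

length-parkCar : ∀ c p s st → length (parkCar c p s st) ≡ length st
length-parkCar c p s []             = refl
length-parkCar c p s (just _ ∷ st)  = cong suc (length-parkCar c p (suc s) st)
length-parkCar c p s (nothing ∷ st) with p ≤ᵇ s
... | true  = refl
... | false = cong suc (length-parkCar c p (suc s) st)

length-parkAll : ∀ c fs st → length (parkAll c fs st) ≡ length st
length-parkAll c []       st = refl
length-parkAll c (p ∷ fs) st = trans (length-parkAll (suc c) fs _) (length-parkCar c p 1 st)

parkAll-++ : ∀ c xs ys st → parkAll c (xs ++ ys) st ≡ parkAll (c + length xs) ys (parkAll c xs st)
parkAll-++ c []       ys st = cong (λ c′ → parkAll c′ ys st) (sym (+-identityʳ c))
parkAll-++ c (x ∷ xs) ys st =
  trans (parkAll-++ (suc c) xs ys _)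
        (cong (λ c′ → parkAll c′ ys (parkAll (suc c) xs (parkCar c x 1 st))) (sym (+-suc c (length xs))))

⊑-parkCar : ∀ c p s st → st ⊑ parkCar c p s st
⊑-parkCar c p s []             = []
⊑-parkCar c p s (just _ ∷ st)  = taken ∷ ⊑-parkCar c p (suc s) st
⊑-parkCar c p s (nothing ∷ st) with p ≤ᵇ s
... | true  = free ∷ ⊑-refl
... | false = free ∷ ⊑-parkCar c p (suc s) st

⊑-parkAll : ∀ c fs st → st ⊑ parkAll c fs st
⊑-parkAll c []       st = ⊑-refl
⊑-parkAll c (p ∷ fs) st = ⊑-trans (⊑-parkCar c p 1 st) (⊑-parkAll (suc c) fs _)

parkCar-shape : ∀ c p s st → parkCar c p s st ≡ st ⊎
  ∃₂ λ A B → st ≡ A ++ nothing ∷ B × parkCar c p s st ≡ A ++ just c ∷ B × p ≤ s + length A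
parkCar-shape c p s [] = inj₁ refl
parkCar-shape c p s (just d ∷ st) with parkCar-shape c p (suc s) st
... | inj₁ e = inj₁ (cong (just d ∷_) e)
... | inj₂ (A , B , refl , e , p≤) =
  inj₂ (just d ∷ A , B , refl , cong (just d ∷_) e , subst (p ≤_) (sym (+-suc s (length A))) p≤)
parkCar-shape c p s (nothing ∷ st) with p ≤ᵇ s in eq
... | true = inj₂ ([] , st , refl , refl , subst (p ≤_) (sym (+-identityʳ s)) (≤ᵇ⇒≤ p s (subst T (sym eq) tt)))
... | false with parkCar-shape c p (suc s) st
...   | inj₁ e = inj₁ (cong (nothing ∷_) e)
...   | inj₂ (A , B , refl , e , p≤) =
  inj₂ (nothing ∷ A , B , refl , cong (nothing ∷_) e , subst (p ≤_) (sym (+-suc s (length A))) p≤)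

catMaybes-parkCar : ∀ c p s st → catMaybes (parkCar c p s st) ≡ catMaybes st ⊎
  ∃₂ λ xs ys → catMaybes st ≡ xs ++ ys × catMaybes (parkCar c p s st) ≡ xs ++ c ∷ ys
catMaybes-parkCar c p s st with parkCar-shape c p s st
... | inj₁ e = inj₁ (cong catMaybes e)
... | inj₂ (A , B , refl , e , _) =
  inj₂ (catMaybes A , catMaybes B , catMaybes-++ A (nothing ∷ B) , trans (cong catMaybes e) (catMaybes-++ A (just c ∷ B)))

length-catMaybes-parkCar : ∀ c p s st → length (catMaybes (parkCar c p s st)) ≤ suc (length (catMaybes st))
length-catMaybes-parkCar c p s st with catMaybes-parkCar c p s st
... | inj₁ e = ≤-trans (≤-reflexive (cong length e)) (n≤1+n _)
... | inj₂ (xs , ys , e , e′) rewrite e | e′ = ≤-reflexive (length-++-sucʳ xs c ys)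

length-catMaybes-parkAll : ∀ c fs st → length (catMaybes (parkAll c fs st)) ≤ length fs + length (catMaybes st)
length-catMaybes-parkAll c []       st = ≤-refl
length-catMaybes-parkAll c (p ∷ fs) st = begin
  length (catMaybes (parkAll (suc c) fs (parkCar c p 1 st))) ≤⟨ length-catMaybes-parkAll (suc c) fs _ ⟩
  length fs + length (catMaybes (parkCar c p 1 st))          ≤⟨ +-monoʳ-≤ (length fs) (length-catMaybes-parkCar c p 1 st) ⟩
  length fs + suc (length (catMaybes st))                    ≡⟨ +-suc (length fs) _ ⟩
  suc (length fs + length (catMaybes st))                    ∎
  where open ≤-Reasoning

All-catMaybes-parkCar : ∀ {P : ℕ → Set} c p s st → All P (catMaybes st) → P c → All P (catMaybes (parkCar c p s st))
All-catMaybes-parkCar c p s st Pst Pc with catMaybes-parkCar c p s st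
... | inj₁ e = subst (All _) (sym e) Pst
... | inj₂ (xs , ys , e , e′) rewrite e | e′ = All-insert xs Pst Pc

catMaybes-parkAll-< : ∀ c fs st → All (_< c) (catMaybes st) → All (_< c + length fs) (catMaybes (parkAll c fs st))
catMaybes-parkAll-< c []       st <c = subst (λ b → All (_< b) (catMaybes st)) (sym (+-identityʳ c)) <c
catMaybes-parkAll-< c (p ∷ fs) st <c =
  subst (λ b → All (_< b) (catMaybes (parkAll c (p ∷ fs) st))) (sym (+-suc c (length fs)))
    (catMaybes-parkAll-< (suc c) fs _ (All-catMaybes-parkCar c p 1 st (All.map m<n⇒m<1+n <c) ≤-refl))

Unique-catMaybes-parkAll : ∀ c fs st → Unique (catMaybes st) → All (_< c) (catMaybes st) →
  Unique (catMaybes (parkAll c fs st))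
Unique-catMaybes-parkAll c []       st u <c = u
Unique-catMaybes-parkAll c (p ∷ fs) st u <c =
  Unique-catMaybes-parkAll (suc c) fs _ u′ (All-catMaybes-parkCar c p 1 st (All.map m<n⇒m<1+n <c) ≤-refl)
  where
  u′ : Unique (catMaybes (parkCar c p 1 st))
  u′ with catMaybes-parkCar c p 1 st
  ... | inj₁ e = subst Unique (sym e) u
  ... | inj₂ (xs , ys , e , e′) rewrite e | e′ = Unique-insert xs u (All.map (λ x<c x≡c → <-irrefl x≡c x<c) <c)

AllParked : ℕ → List ℕ → Street → Set
AllParked c fs st = length (catMaybes (parkAll c fs st)) ≡ length fs + length (catMaybes st)

AllParked-∷ : ∀ c p fs st → AllParked c (p ∷ fs) st →
  length (catMaybes (parkCar c p 1 st)) ≡ suc (length (catMaybes st)) × AllParked (suc c) fs (parkCar c p 1 st)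
AllParked-∷ c p fs st parked = first , trans parked (trans (sym (+-suc (length fs) _)) (cong (length fs +_) (sym first)))
  where
  first : length (catMaybes (parkCar c p 1 st)) ≡ suc (length (catMaybes st))
  first = ≤-antisym (length-catMaybes-parkCar c p 1 st) (+-cancelˡ-≤ (length fs) _ _ (begin
    length fs + suc (length (catMaybes st))             ≡⟨ +-suc (length fs) _ ⟩
    suc (length fs + length (catMaybes st))             ≡⟨ sym parked ⟩
    length (catMaybes (parkAll c (p ∷ fs) st))          ≤⟨ length-catMaybes-parkAll (suc c) fs _ ⟩
    length fs + length (catMaybes (parkCar c p 1 st))   ∎))
    where open ≤-Reasoning

∈-catMaybes-parkCar : ∀ c p s st → length (catMaybes (parkCar c p s st)) ≡ suc (length (catMaybes st)) →
  c ∈ catMaybes (parkCar c p s st)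
∈-catMaybes-parkCar c p s st grew with catMaybes-parkCar c p s st
... | inj₁ e = contradiction (n<1+n _) (<-irrefl (trans (sym (cong length e)) grew))
... | inj₂ (xs , ys , _ , e′) rewrite e′ = ∈-++⁺ʳ xs (here refl)

∈-catMaybes-parkAll : ∀ c fs st → AllParked c fs st → ∀ {k} → c ≤ k → k < c + length fs →
  k ∈ catMaybes (parkAll c fs st)
∈-catMaybes-parkAll c [] st _ c≤k k<c+0 = contradiction (subst (_ <_) (+-identityʳ c) k<c+0) (≤⇒≯ c≤k)
∈-catMaybes-parkAll c (p ∷ fs) st parked {k} c≤k k< with AllParked-∷ c p fs st parked | m≤n⇒m<n∨m≡n c≤k
... | first , _    | inj₂ refl = ∈-catMaybes-⊑ (⊑-parkAll (suc c) fs _) (∈-catMaybes-parkCar c p 1 st first)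
... | _    , rest | inj₁ c<k  = ∈-catMaybes-parkAll (suc c) fs _ rest c<k (subst (k <_) (+-suc c (length fs)) k<)

filled-prefix⇒≤ : ∀ c hs a R xs R′ → parkAll c hs (emptyStreet a ++ R) ≡ map just xs ++ R′ → length xs ≡ a →
  a ≤ length hs
filled-prefix⇒≤ c hs a R xs R′ eq refl
  with ⊑-splitʳ (map just xs) (subst ((emptyStreet a ++ R) ⊑_) eq (⊑-parkAll c hs _))
... | A , B , e , A⊑ , B⊑
  with ++-injective (emptyStreet a) A (trans (length-emptyStreet a) (sym (trans (Pointwise.Pointwise-length A⊑) (length-map just xs)))) e
... | refl , refl = +-cancelʳ-≤ (length (catMaybes R)) _ _ (begin
  length xs + length (catMaybes R)                          ≤⟨ +-monoʳ-≤ (length xs) (length-catMaybes-⊑ B⊑) ⟩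
  length xs + length (catMaybes R′)                         ≡⟨ sym (length-++ xs) ⟩
  length (xs ++ catMaybes R′)                               ≡⟨ cong length (sym (catMaybes-map-just-++ xs R′)) ⟩
  length (catMaybes (map just xs ++ R′))                    ≡⟨ cong (length ∘ catMaybes) (sym eq) ⟩
  length (catMaybes (parkAll c hs (emptyStreet a ++ R)))    ≤⟨ length-catMaybes-parkAll c hs _ ⟩
  length hs + length (catMaybes (emptyStreet a ++ R))       ≡⟨ cong (λ cs → length hs + length cs) (catMaybes-emptyStreet-++ a R) ⟩
  length hs + length (catMaybes R)                          ∎)
  where open ≤-Reasoning

parkCar-into-emptyStreet : ∀ c i e X → i < e →
  parkCar c (suc i) 1 (emptyStreet e ++ X) ≡ emptyStreet i ++ just c ∷ (emptyStreet (e ∸ suc i) ++ X)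
parkCar-into-emptyStreet c i e X i<e =
  subst (λ p → parkCar c p 1 (emptyStreet e ++ X) ≡ emptyStreet i ++ just c ∷ (emptyStreet (e ∸ suc i) ++ X))
        (+-comm i 1) (go i e 1 i<e)
  where
  go : ∀ i e s → i < e → parkCar c (i + s) s (emptyStreet e ++ X) ≡ emptyStreet i ++ just c ∷ (emptyStreet (e ∸ suc i) ++ X)
  go zero    (suc e) s _ rewrite ≤ᵇ-true (≤-refl {s}) = refl
  go (suc i) (suc e) s (s≤s i<e) rewrite ≤ᵇ-false {suc i + s} {s} (s≤s (m≤n+m s i)) =
    cong (nothing ∷_) (trans (cong (λ p → parkCar c p (suc s) (emptyStreet e ++ X)) (sym (+-suc i s))) (go i e (suc s) i<e))

parkCar-end-of-emptyStreet : ∀ c a X → parkCar c (suc a) 1 (emptyStreet (suc a) ++ X) ≡ emptyStreet a ++ just c ∷ X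
parkCar-end-of-emptyStreet c a X =
  trans (parkCar-into-emptyStreet c a (suc a) X ≤-refl) (cong (λ k → emptyStreet a ++ just c ∷ (emptyStreet k ++ X)) (n∸n≡0 a))

parkCar-past-emptyStreet : ∀ c p e s X → e + s ≤ p →
  parkCar c p s (emptyStreet e ++ X) ≡ emptyStreet e ++ parkCar c p (e + s) X
parkCar-past-emptyStreet c p zero    s X _ = refl
parkCar-past-emptyStreet c p (suc e) s X e+s<p rewrite ≤ᵇ-false {p} {s} (≤-trans (s≤s (m≤n+m s e)) e+s<p) =
  cong (nothing ∷_) (trans (parkCar-past-emptyStreet c p e (suc s) X (subst (_≤ p) (sym (+-suc e s)) e+s<p))
                           (cong (λ s′ → emptyStreet e ++ parkCar c p s′ X) (+-suc e s)))

parkCar-shift : ∀ c k p s X → parkCar c (k + p) (k + s) X ≡ parkCar c p s X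
parkCar-shift c k p s []            = refl
parkCar-shift c k p s (just d ∷ X)  =
  cong (just d ∷_) (trans (cong (λ s′ → parkCar c (k + p) s′ X) (sym (+-suc k s))) (parkCar-shift c k p (suc s) X))
parkCar-shift c k p s (nothing ∷ X) rewrite +-≤ᵇ-+ k p s with p ≤ᵇ s
... | true  = refl
... | false =
  cong (nothing ∷_) (trans (cong (λ s′ → parkCar c (k + p) s′ X) (sym (+-suc k s))) (parkCar-shift c k p (suc s) X))

parkCar-behind-emptyStreet : ∀ c e q X → 1 ≤ q → parkCar c (e + q) 1 (emptyStreet e ++ X) ≡ emptyStreet e ++ parkCar c q 1 X
parkCar-behind-emptyStreet c e q X 1≤q =
  trans (parkCar-past-emptyStreet c (e + q) e 1 X (+-monoʳ-≤ e 1≤q)) (cong (emptyStreet e ++_) (parkCar-shift c e q 1 X))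

parkCar-beyond-emptyStreet : ∀ c e q X → e < q → parkCar c q 1 (emptyStreet e ++ X) ≡ emptyStreet e ++ parkCar c (q ∸ e) 1 X
parkCar-beyond-emptyStreet c e q X e<q =
  trans (cong (λ p → parkCar c p 1 (emptyStreet e ++ X)) (sym (m+[n∸m]≡n (<⇒≤ e<q))))
        (parkCar-behind-emptyStreet c e (q ∸ e) X (m<n⇒0<n∸m e<q))

parkCar-first-free : ∀ c p s xs M → p ≤ s + length xs → parkCar c p s (map just xs ++ nothing ∷ M) ≡ map just xs ++ just c ∷ M
parkCar-first-free c p s []       M p≤s+0 rewrite ≤ᵇ-true (subst (p ≤_) (+-identityʳ s) p≤s+0) = refl
parkCar-first-free c p s (x ∷ xs) M p≤ = cong (just x ∷_) (parkCar-first-free c p (suc s) xs M (subst (p ≤_) (+-suc s (length xs)) p≤))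

desc : ℕ → ℕ → List ℕ
desc r zero    = []
desc r (suc j) = suc (r + j) ∷ desc r j

desc-∷ʳ : ∀ r j → desc r (suc j) ≡ desc (suc r) j ++ [ suc r ]
desc-∷ʳ r zero    = cong [_] (cong suc (+-identityʳ r))
desc-∷ʳ r (suc j) = cong₂ _∷_ (cong suc (+-suc r j)) (desc-∷ʳ r j)

desc-+ : ∀ j t → desc 0 (t + j) ≡ desc j t ++ desc 0 j
desc-+ j zero    = refl
desc-+ j (suc t) = cong₂ _∷_ (cong suc (+-comm t j)) (desc-+ j t)

length-desc : ∀ r j → length (desc r j) ≡ j
length-desc r zero    = refl
length-desc r (suc j) = cong suc (length-desc r j)

∈-desc⇒> : ∀ r j {x} → x ∈ desc r j → r < x
∈-desc⇒> r (suc j) (here refl) = s≤s (m≤m+n r j)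
∈-desc⇒> r (suc j) (there x∈) = ∈-desc⇒> r j x∈

∈-desc⇒≤ : ∀ r j {x} → x ∈ desc r j → x ≤ r + j
∈-desc⇒≤ r (suc j) (here refl) = ≤-reflexive (sym (+-suc r j))
∈-desc⇒≤ r (suc j) (there x∈) = ≤-trans (∈-desc⇒≤ r j x∈) (+-monoʳ-≤ r (n≤1+n j))

∈-desc⁺ : ∀ r j {x} → r < x → x ≤ r + j → x ∈ desc r j
∈-desc⁺ r zero    r<x x≤r+0 = contradiction (≤-trans r<x (subst (_ ≤_) (+-identityʳ r) x≤r+0)) (<-irrefl refl)
∈-desc⁺ r (suc j) {x} r<x x≤ with m≤n⇒m<n∨m≡n (subst (x ≤_) (+-suc r j) x≤)
... | inj₁ x<  = there (∈-desc⁺ r j r<x (≤-pred x<))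
... | inj₂ x≡ = here x≡

map-just-desc-∷ʳ : ∀ r j (R : Street) → map just (desc r (suc j)) ++ R ≡ map just (desc (suc r) j) ++ just (suc r) ∷ R
map-just-desc-∷ʳ r j R = begin
  map just (desc r (suc j)) ++ R                      ≡⟨ cong (λ xs → map just xs ++ R) (desc-∷ʳ r j) ⟩
  map just (desc (suc r) j ++ [ suc r ]) ++ R         ≡⟨ cong (_++ R) (map-++ just (desc (suc r) j) [ suc r ]) ⟩
  (map just (desc (suc r) j) ++ [ just (suc r) ]) ++ R ≡⟨ ++-assoc (map just (desc (suc r) j)) _ R ⟩
  map just (desc (suc r) j) ++ just (suc r) ∷ R       ∎
  where open ≡-Reasoning

parkAll-desc : ∀ a r R → parkAll (suc r) (desc 0 a) (emptyStreet a ++ R) ≡ map just (desc r a) ++ R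
parkAll-desc zero    r R = refl
parkAll-desc (suc a) r R = begin
  parkAll (suc (suc r)) (desc 0 a) (parkCar (suc r) (suc a) 1 (emptyStreet (suc a) ++ R))
    ≡⟨ cong (parkAll (suc (suc r)) (desc 0 a)) (parkCar-end-of-emptyStreet (suc r) a R) ⟩
  parkAll (suc (suc r)) (desc 0 a) (emptyStreet a ++ just (suc r) ∷ R)
    ≡⟨ parkAll-desc a (suc r) (just (suc r) ∷ R) ⟩
  map just (desc (suc r) a) ++ just (suc r) ∷ R
    ≡⟨ sym (map-just-desc-∷ʳ r a R) ⟩
  map just (desc r (suc a)) ++ R ∎
  where open ≡-Reasoning

-- The first car r+1 must take the last spot of the block: an earlier spot is where a larger car ends
-- up, and if it drives past the block the remaining cars are too few to fill it.
parkAll-desc⁻ : ∀ a r hs R R′ → All (1 ≤_) hs → length hs ≡ a →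
  parkAll (suc r) hs (emptyStreet a ++ R) ≡ map just (desc r a) ++ R′ → hs ≡ desc 0 a × R′ ≡ R
parkAll-desc⁻ zero    r []       R R′ _ _ eq = refl , sym eq
parkAll-desc⁻ (suc a) r (suc i ∷ hs) R R′ (s≤s z≤n ∷ hs≥1) len eq with <-cmp (suc i) (suc a)
... | tri< i<a _ _ = contradiction (∈-desc⇒> (suc r) a r+1∈) (<-irrefl refl)
  where
  r+1∈ : suc r ∈ desc (suc r) a
  r+1∈ = ⊑-just-in (emptyStreet i) (desc (suc r) a)
           (subst₂ _⊑_ (parkCar-into-emptyStreet (suc r) i (suc a) R (m<n⇒m<1+n (≤-pred i<a)))
                       (trans eq (map-just-desc-∷ʳ r a R′)) (⊑-parkAll (suc (suc r)) hs _))
           (subst₂ _<_ (sym (length-emptyStreet i)) (sym (length-desc (suc r) a)) (≤-pred i<a))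
... | tri≈ _ refl _ with parkAll-desc⁻ a (suc r) hs (just (suc r) ∷ R) (just (suc r) ∷ R′) hs≥1 (suc-injective len)
                       (trans (cong (parkAll (suc (suc r)) hs) (sym (parkCar-end-of-emptyStreet (suc r) a R)))
                              (trans eq (map-just-desc-∷ʳ r a R′)))
...   | refl , refl = refl , refl
parkAll-desc⁻ (suc a) r (suc i ∷ hs) R R′ (s≤s z≤n ∷ hs≥1) len eq | tri> _ _ a<i =
  contradiction (subst (suc a ≤_) (suc-injective len)
                  (filled-prefix⇒≤ (suc (suc r)) hs (suc a) _ (desc r (suc a)) R′ eq′ (length-desc r (suc a))))
                (<-irrefl refl)
  where
  eq′ = trans (cong (parkAll (suc (suc r)) hs) (sym (parkCar-beyond-emptyStreet (suc r) (suc a) (suc i) R a<i))) eq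

parkAll-behind-emptyStreet : ∀ e c g X → All (1 ≤_) g →
  parkAll c (map (e +_) g) (emptyStreet e ++ X) ≡ emptyStreet e ++ parkAll c g X
parkAll-behind-emptyStreet e c []      X _             = refl
parkAll-behind-emptyStreet e c (q ∷ g) X (1≤q ∷ g≥1) =
  trans (cong (parkAll (suc c) (map (e +_) g)) (parkCar-behind-emptyStreet c e q X 1≤q))
        (parkAll-behind-emptyStreet e (suc c) g _ g≥1)

parkAll-behind-emptyStreet⁻ : ∀ e c hs X Y → All (1 ≤_) hs →
  parkAll c hs (emptyStreet e ++ X) ≡ emptyStreet e ++ Y →
  ∃ λ g → hs ≡ map (e +_) g × All (1 ≤_) g × parkAll c g X ≡ Y
parkAll-behind-emptyStreet⁻ e c [] X Y _ eq = [] , refl , [] , proj₂ (++-injective (emptyStreet e) (emptyStreet e) refl eq)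
parkAll-behind-emptyStreet⁻ e c (suc i ∷ hs) X Y (_ ∷ hs≥1) eq with suc i ≤? e
... | yes i<e = contradiction
  (subst₂ _⊑_ (parkCar-into-emptyStreet c i e X i<e) eq (⊑-parkAll (suc c) hs _) ,
   subst (_< e) (sym (length-emptyStreet i)) i<e)
  (⊑-just-emptyStreet (emptyStreet i) e)
... | no i≮e with parkAll-behind-emptyStreet⁻ e (suc c) hs (parkCar c (suc i ∸ e) 1 X) Y hs≥1
                    (trans (cong (parkAll (suc c) hs) (sym (parkCar-beyond-emptyStreet c e (suc i) X (≰⇒> i≮e)))) eq)
...   | g , refl , g≥1 , eq′ =
  suc i ∸ e ∷ g , cong (_∷ map (e +_) g) (sym (m+[n∸m]≡n (<⇒≤ (≰⇒> i≮e)))) , m<n⇒0<n∸m (≰⇒> i≮e) ∷ g≥1 , eq′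

-- Parking functions park every car

∈-range⁺ : ∀ {n i} → 1 ≤ i → i ≤ n → i ∈ range n
∈-range⁺ {i = suc i} _ i<n = ∈-map⁺ suc (∈-upTo⁺ i<n)

∈-range⁻ : ∀ {n i} → i ∈ range n → 1 ≤ i × i ≤ n
∈-range⁻ i∈ with ∈-map⁻ suc i∈
... | _ , j∈ , refl = s≤s z≤n , ∈-upTo⁻ j∈

isParking⁻ : ∀ n f {i} → T (isParking n f) → i ≤ n → i ≤ count (_≤ᵇ i) f
isParking⁻ n f {zero}  park _   = z≤n
isParking⁻ n f {suc i} park i<n = ≤ᵇ⇒≤ _ _ (All.lookup (All.all⁺ _ (range n) park) (∈-range⁺ (s≤s z≤n) i<n))

parkCar-before-free : ∀ c p s X Y → p ≤ s + length X →
  parkCar c p s (X ++ nothing ∷ Y) ≡ X ++ just c ∷ Y ⊎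
  ∃ λ X′ → parkCar c p s (X ++ nothing ∷ Y) ≡ X′ ++ nothing ∷ Y × length X′ ≡ length X ×
           length (catMaybes X′) ≡ suc (length (catMaybes X))
parkCar-before-free c p s [] Y p≤s+0 rewrite ≤ᵇ-true (subst (p ≤_) (+-identityʳ s) p≤s+0) = inj₁ refl
parkCar-before-free c p s (just d ∷ X) Y p≤ with parkCar-before-free c p (suc s) X Y (subst (p ≤_) (+-suc s (length X)) p≤)
... | inj₁ e                      = inj₁ (cong (just d ∷_) e)
... | inj₂ (X′ , e , len , occ) = inj₂ (just d ∷ X′ , cong (just d ∷_) e , cong suc len , cong suc occ)
parkCar-before-free c p s (nothing ∷ X) Y p≤ with p ≤ᵇ s
... | true  = inj₂ (just c ∷ X , refl , refl , refl)
... | false with parkCar-before-free c p (suc s) X Y (subst (p ≤_) (+-suc s (length X)) p≤)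
...   | inj₁ e                      = inj₁ (cong (nothing ∷_) e)
...   | inj₂ (X′ , e , len , occ) = inj₂ (nothing ∷ X′ , cong (nothing ∷_) e , cong suc len , occ)

parkCar-free-spot : ∀ c q k X Y X₁ Y₁ → length X ≡ k → X ⊑ X₁ →
  parkCar c q 1 (X ++ nothing ∷ Y) ≡ X₁ ++ nothing ∷ Y₁ →
  count (_≤ᵇ suc k) [ q ] + length (catMaybes X) ≤ length (catMaybes X₁)
parkCar-free-spot c q k X Y X₁ Y₁ refl X⊑X₁ eq with q ≤? suc k
... | no q≰ = subst (_≤ length (catMaybes X₁)) (sym (cong (_+ _) (count-reject (_≤ᵇ suc k) q [] (q≰ ∘ ≤ᵇ⇒≤ _ _))))
                    (length-catMaybes-⊑ X⊑X₁)
... | yes q≤ with parkCar-before-free c q 1 X Y q≤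
...   | inj₁ e = contradiction
  (proj₁ (∷-injective (proj₂ (++-injective X X₁ (Pointwise.Pointwise-length X⊑X₁) (trans (sym e) eq))))) λ ()
...   | inj₂ (X″ , e , lenX″ , occ) with ++-injective X″ X₁ (trans lenX″ (Pointwise.Pointwise-length X⊑X₁)) (trans (sym e) eq)
...     | refl , _ = ≤-reflexive (trans (cong (_+ _) (count-accept (_≤ᵇ suc k) q [] (≤⇒≤ᵇ q≤))) (sym occ))

-- A spot that is free at the end was free all along, so no car preferring it or an earlier spot
-- got past it: those cars all parked in front of it.
free-spot-count : ∀ c hs k X Y X′ Y′ → length X ≡ k → length X′ ≡ k →
  parkAll c hs (X ++ nothing ∷ Y) ≡ X′ ++ nothing ∷ Y′ →
  count (_≤ᵇ suc k) hs + length (catMaybes X) ≤ length (catMaybes X′)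
free-spot-count c [] k X Y X′ Y′ lenX lenX′ eq with ++-injective X X′ (trans lenX (sym lenX′)) eq
... | refl , _ = ≤-refl
free-spot-count c (q ∷ hs) k X Y X′ Y′ lenX lenX′ eq
  with ⊑-free X X′ (⊑-parkCar c q 1 (X ++ nothing ∷ Y)) (subst (_ ⊑_) eq (⊑-parkAll (suc c) hs _)) (trans lenX (sym lenX′))
... | X₁ , Y₁ , st₁≡ , X⊑X₁ , lenX₁ = begin
  count (_≤ᵇ suc k) (q ∷ hs) + length (catMaybes X)          ≡⟨ cong (_+ _) (count-++ (_≤ᵇ suc k) [ q ] hs) ⟩
  (cq + count (_≤ᵇ suc k) hs) + length (catMaybes X)         ≡⟨ trans (cong (_+ length (catMaybes X)) (+-comm cq _))
                                                                      (+-assoc (count (_≤ᵇ suc k) hs) cq _) ⟩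
  count (_≤ᵇ suc k) hs + (cq + length (catMaybes X))         ≤⟨ +-monoʳ-≤ _ (parkCar-free-spot c q k X Y X₁ Y₁ lenX X⊑X₁ st₁≡) ⟩
  count (_≤ᵇ suc k) hs + length (catMaybes X₁)               ≤⟨ free-spot-count (suc c) hs k X₁ Y₁ X′ Y′ (trans lenX₁ lenX) lenX′
                                                                   (trans (cong (parkAll (suc c) hs) (sym st₁≡)) eq) ⟩
  length (catMaybes X′)                                      ∎
  where
  open ≤-Reasoning
  cq = count (_≤ᵇ suc k) [ q ]

full-or-free : ∀ (st : Street) → (∃ λ xs → st ≡ map just xs) ⊎ ∃₂ λ X Y → st ≡ X ++ nothing ∷ Y
full-or-free []             = inj₁ ([] , refl)
full-or-free (nothing ∷ st) = inj₂ ([] , st , refl)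
full-or-free (just c ∷ st) with full-or-free st
... | inj₁ (xs , e)    = inj₁ (c ∷ xs , cong (just c ∷_) e)
... | inj₂ (X , Y , e) = inj₂ (just c ∷ X , Y , cong (just c ∷_) e)

isParking⇒parks : ∀ n f → T (isParking n f) → ∃ λ ρ → parkAll 1 f (emptyStreet n) ≡ map just ρ
isParking⇒parks n f park with full-or-free (parkAll 1 f (emptyStreet n))
... | inj₁ full            = full
... | inj₂ (X′ , Y′ , eq) = contradiction (≤-trans (isParking⁻ n f park m<n) count≤m) (<-irrefl refl)
  where
  m = length X′
  m<n : m < n
  m<n = begin-strict
    m                                     <⟨ m<m+n m (s≤s z≤n) ⟩
    m + suc (length Y′)                   ≡⟨ sym (length-++ X′) ⟩
    length (X′ ++ nothing ∷ Y′)           ≡⟨ cong length (sym eq) ⟩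
    length (parkAll 1 f (emptyStreet n))  ≡⟨ trans (length-parkAll 1 f _) (length-emptyStreet n) ⟩
    n                                     ∎
    where open ≤-Reasoning
  split : emptyStreet n ≡ emptyStreet m ++ nothing ∷ emptyStreet (n ∸ suc m)
  split = trans (cong emptyStreet (sym (m+[n∸m]≡n m<n)))
                (trans (emptyStreet-+ (suc m) _) (sym (emptyStreet-∷ʳ m _)))
  count≤m : count (_≤ᵇ suc m) f ≤ m
  count≤m = begin
    count (_≤ᵇ suc m) f                                                ≤⟨ m≤m+n _ _ ⟩
    count (_≤ᵇ suc m) f + length (catMaybes (emptyStreet m))           ≤⟨ free-spot-count 1 f m (emptyStreet m) _ X′ Y′
                                                                            (length-emptyStreet m) refl
                                                                            (trans (cong (parkAll 1 f) (sym split)) eq) ⟩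
    length (catMaybes X′)                                              ≤⟨ length-catMaybes X′ ⟩
    m                                                                  ∎
    where open ≤-Reasoning

-- Pattern avoidance

Avoids : List ℕ → List ℕ → Set
Avoids π σ = ¬ T (contains π σ)

∈-subseqs⁺ : ∀ {ys xs : List ℕ} → ys ⊆ xs → ys ∈ subseqs (length ys) xs
∈-subseqs⁺ []                    = here refl
∈-subseqs⁺ {[]}     (_ ∷ʳ _)    = here refl
∈-subseqs⁺ {_ ∷ ys} (x ∷ʳ τ)    = ∈-++⁺ʳ (map (x ∷_) (subseqs (length ys) _)) (∈-subseqs⁺ τ)
∈-subseqs⁺          (refl ∷ τ)  = ∈-++⁺ˡ (∈-map⁺ _ (∈-subseqs⁺ τ))

∈-subseqs⁻ : ∀ m (xs : List ℕ) {ys} → ys ∈ subseqs m xs → ys ⊆ xs × length ys ≡ m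
∈-subseqs⁻ zero    xs       (here refl) = minimum xs , refl
∈-subseqs⁻ (suc m) (x ∷ xs) ys∈ with ∈-++⁻ (map (x ∷_) (subseqs m xs)) ys∈
... | inj₁ ys∈ₗ with ∈-map⁻ (x ∷_) ys∈ₗ
...   | zs , zs∈ , refl with ∈-subseqs⁻ m xs zs∈
...     | τ , len = refl ∷ τ , cong suc len
∈-subseqs⁻ (suc m) (x ∷ xs) ys∈ | inj₂ ys∈ᵣ with ∈-subseqs⁻ (suc m) xs ys∈ᵣ
... | τ , len = x ∷ʳ τ , len

contains⁺ : ∀ {ys π σ} → ys ⊆ π → length ys ≡ length σ → T (orderIso ys σ) → T (contains π σ)
contains⁺ {ys} {π} τ len iso = any⁺ _ (lose (subst (λ m → ys ∈ subseqs m π) len (∈-subseqs⁺ τ)) iso)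

contains⁻ : ∀ π σ → T (contains π σ) → ∃ λ ys → ys ⊆ π × length ys ≡ length σ × T (orderIso ys σ)
contains⁻ π σ c with find (any⁻ _ (subseqs (length σ) π) c)
... | ys , ys∈ , iso = ys , proj₁ (∈-subseqs⁻ (length σ) π ys∈) , proj₂ (∈-subseqs⁻ (length σ) π ys∈) , iso

Avoids-++⁻ : ∀ A B σ → Avoids (A ++ B) σ → Avoids B σ
Avoids-++⁻ A B σ av c with contains⁻ B σ c
... | ys , τ , len , iso = av (contains⁺ (++⁺ˡ A τ) len iso)

==-true : ∀ b c → T c → T (b == c) → T b
==-true true  _     _  _ = tt
==-true false true  _  ()
==-true false false () _

orderIso⇒< : ∀ xs σ {x s y t} → T (orderIso xs σ) → (x , s) ∈ zip xs σ → (y , t) ∈ zip xs σ → T (s <ᵇ t) → x < y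
orderIso⇒< xs σ {x} {s} {y} {t} iso xs∈ yt∈ s<t =
  <ᵇ⇒< x y (==-true (x <ᵇ y) (s <ᵇ t) s<t (All.lookup (All.all⁺ _ (zip xs σ) (All.lookup (All.all⁺ _ (zip xs σ) iso) xs∈)) yt∈))

MinFirst : List ℕ → Set
MinFirst σ = ∀ {x y z} → T (orderIso (x ∷ y ∷ z ∷ []) σ) → x < y × x < z × y ≢ z

minFirst-123 : MinFirst p123
minFirst-123 {x} {y} {z} iso =
  orderIso⇒< (x ∷ y ∷ z ∷ []) p123 iso (here refl) (there (here refl)) tt ,
  orderIso⇒< (x ∷ y ∷ z ∷ []) p123 iso (here refl) (there (there (here refl))) tt ,
  <⇒≢ (orderIso⇒< (x ∷ y ∷ z ∷ []) p123 iso (there (here refl)) (there (there (here refl))) tt)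

minFirst-132 : MinFirst p132
minFirst-132 {x} {y} {z} iso =
  orderIso⇒< (x ∷ y ∷ z ∷ []) p132 iso (here refl) (there (here refl)) tt ,
  orderIso⇒< (x ∷ y ∷ z ∷ []) p132 iso (here refl) (there (there (here refl))) tt ,
  ≢-sym (<⇒≢ (orderIso⇒< (x ∷ y ∷ z ∷ []) p132 iso (there (there (here refl))) (there (here refl)) tt))

orderIso-123 : ∀ {x y z} → x < y → y < z → T (orderIso (x ∷ y ∷ z ∷ []) p123)
orderIso-123 {x} {y} {z} x<y y<z
  rewrite <ᵇ-false (≤-refl {x}) | <ᵇ-false (≤-refl {y}) | <ᵇ-false (≤-refl {z})
        | <ᵇ-true x<y | <ᵇ-true y<z | <ᵇ-true (<-trans x<y y<z)
        | <ᵇ-false (<⇒≤ x<y) | <ᵇ-false (<⇒≤ y<z) | <ᵇ-false (<⇒≤ (<-trans x<y y<z)) = tt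

orderIso-132 : ∀ {x y z} → x < z → z < y → T (orderIso (x ∷ y ∷ z ∷ []) p132)
orderIso-132 {x} {y} {z} x<z z<y
  rewrite <ᵇ-false (≤-refl {x}) | <ᵇ-false (≤-refl {y}) | <ᵇ-false (≤-refl {z})
        | <ᵇ-true x<z | <ᵇ-true z<y | <ᵇ-true (<-trans x<z z<y)
        | <ᵇ-false (<⇒≤ x<z) | <ᵇ-false (<⇒≤ z<y) | <ᵇ-false (<⇒≤ (<-trans x<z z<y)) = tt

length≡2 : ∀ (ys : List ℕ) → length ys ≡ 2 → ∃₂ λ y z → ys ≡ y ∷ z ∷ []
length≡2 (y ∷ z ∷ []) refl = y , z , refl

-- An occurrence starting at x needs two distinct later entries above x.
Avoids-∷ : ∀ {s a b} → MinFirst (s ∷ a ∷ b ∷ []) → ∀ x xs N → All (λ w → w ≤ x ⊎ w ≡ N) xs →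
  Avoids xs (s ∷ a ∷ b ∷ []) → Avoids (x ∷ xs) (s ∷ a ∷ b ∷ [])
Avoids-∷ minFirst x xs N bound av c with contains⁻ (x ∷ xs) _ c
... | ys , _ ∷ʳ τ , len , iso = av (contains⁺ τ len iso)
... | _ ∷ ys , refl ∷ τ , len , iso with length≡2 ys (suc-injective len)
...   | y , z , refl with minFirst iso | All-resp-⊆ τ bound
...     | x<y , x<z , y≢z | inj₁ y≤x ∷ _ = <⇒≱ x<y y≤x
...     | x<y , x<z , y≢z | inj₂ _ ∷ inj₁ z≤x ∷ [] = <⇒≱ x<z z≤x
...     | x<y , x<z , y≢z | inj₂ y≡N ∷ inj₂ z≡N ∷ [] = y≢z (trans y≡N (sym z≡N))

Avoids-desc : ∀ {s a b} → MinFirst (s ∷ a ∷ b ∷ []) → ∀ j r N ρ → r + j < N → All (_≤ r) ρ →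
  Avoids ρ (s ∷ a ∷ b ∷ []) → Avoids (desc r j ++ N ∷ ρ) (s ∷ a ∷ b ∷ [])
Avoids-desc minFirst zero r N ρ r+0<N ρ≤r av =
  Avoids-∷ minFirst N ρ N (All.map (λ w≤r → inj₁ (≤-trans w≤r (≤-trans (m≤m+n r 0) (<⇒≤ r+0<N)))) ρ≤r) av
Avoids-desc minFirst (suc j) r N ρ r+j<N ρ≤r av =
  Avoids-∷ minFirst (suc (r + j)) (desc r j ++ N ∷ ρ) N bound
    (Avoids-desc minFirst j r N ρ (≤-trans (s≤s (+-monoʳ-≤ r (n≤1+n j))) r+j<N) ρ≤r av)
  where
  bound : All (λ w → w ≤ suc (r + j) ⊎ w ≡ N) (desc r j ++ N ∷ ρ)
  bound = All.++⁺ (All.tabulate (λ w∈ → inj₁ (m≤n⇒m≤1+n (∈-desc⇒≤ r j w∈))))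
                  (inj₂ refl ∷ All.map (λ w≤r → inj₁ (m≤n⇒m≤1+n (≤-trans w≤r (m≤m+n r j)))) ρ≤r)

-- Before its largest entry n, a 123- and 132-avoider decreases (else y z n is a 123) and stays
-- above everything after n (else y n z is a 132).
avoider-shape : ∀ as n bs → Avoids (as ++ n ∷ bs) p123 → Avoids (as ++ n ∷ bs) p132 →
  Unique (as ++ bs) → All (_< n) (as ++ bs) →
  AllPairs _>_ as × (∀ {a b} → a ∈ as → b ∈ bs → b < a) × Avoids bs p123 × Avoids bs p132
avoider-shape [] n bs av123 av132 _ _ = [] , (λ ()) , Avoids-++⁻ [ n ] bs p123 av123 , Avoids-++⁻ [ n ] bs p132 av132
avoider-shape (y ∷ as) n bs av123 av132 (y∉ ∷ u) (y<n ∷ <n)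
  with avoider-shape as n bs (Avoids-++⁻ [ y ] (as ++ n ∷ bs) p123 av123) (Avoids-++⁻ [ y ] (as ++ n ∷ bs) p132 av132) u <n
... | decreasing , above , av123′ , av132′ = All.tabulate y>as ∷ decreasing , y∷as>bs , av123′ , av132′
  where
  distinct-< : ∀ {z} → z ∈ as ++ bs → ¬ y < z → z < y
  distinct-< z∈ y≮z = ≤∧≢⇒< (≮⇒≥ y≮z) (≢-sym (All.lookup y∉ z∈))
  y>as : ∀ {z} → z ∈ as → z < y
  y>as z∈ = distinct-< (∈-++⁺ˡ z∈) λ y<z →
    av123 (contains⁺ (refl ∷ ++⁺ (from∈ z∈) (refl ∷ minimum bs)) refl (orderIso-123 y<z (All.lookup <n (∈-++⁺ˡ z∈))))
  y∷as>bs : ∀ {a b} → a ∈ y ∷ as → b ∈ bs → b < a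
  y∷as>bs (here refl) b∈ = distinct-< (∈-++⁺ʳ as b∈) λ y<b →
    av132 (contains⁺ (refl ∷ ++⁺ˡ as (refl ∷ from∈ b∈)) refl (orderIso-132 y<b (All.lookup <n (∈-++⁺ʳ as b∈))))
  y∷as>bs (there a∈) b∈ = above a∈ b∈

decreasing-top⇒desc : ∀ j r as bs → length as ≡ j → Unique (as ++ bs) → All (_≤ r + j) (as ++ bs) →
  (∀ {k} → 1 ≤ k → k ≤ r + j → k ∈ as ++ bs) → AllPairs _>_ as → (∀ {a b} → a ∈ as → b ∈ bs → b < a) →
  as ≡ desc r j
decreasing-top⇒desc zero    r []       bs _ _ _ _ _ _ = refl
decreasing-top⇒desc (suc j) r (x ∷ as) bs len (x∉ ∷ u) (x≤ ∷ ≤r+j+1) covers (x>as ∷ decreasing) above =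
  cong₂ _∷_ x≡ (decreasing-top⇒desc j r as bs (suc-injective len) u ≤r+j covers′ decreasing (above ∘ there))
  where
  top : r + suc j ≤ x
  top with covers (subst (1 ≤_) (sym (+-suc r j)) (s≤s z≤n)) ≤-refl
  ... | here e = ≤-reflexive e
  ... | there top∈ with ∈-++⁻ as top∈
  ...   | inj₁ ∈as = <⇒≤ (All.lookup x>as ∈as)
  ...   | inj₂ ∈bs = <⇒≤ (above (here refl) ∈bs)
  x≡ : x ≡ suc (r + j)
  x≡ = trans (≤-antisym x≤ top) (+-suc r j)
  ≤r+j : All (_≤ r + j) (as ++ bs)
  ≤r+j = All.tabulate λ {w} w∈ →
    ≤-pred (≤∧≢⇒< (subst (w ≤_) (+-suc r j) (All.lookup ≤r+j+1 w∈)) λ w≡ → All.lookup x∉ w∈ (trans x≡ (sym w≡)))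
  covers′ : ∀ {k} → 1 ≤ k → k ≤ r + j → k ∈ as ++ bs
  covers′ 1≤k k≤ with covers 1≤k (≤-trans k≤ (+-monoʳ-≤ r (n≤1+n j)))
  ... | here k≡x = contradiction (trans k≡x x≡) (<⇒≢ (s≤s k≤))
  ... | there k∈ = k∈

-- The good parking functions

glue : ℕ → ℕ → List ℕ → List ℕ
glue j p g = map (suc j +_) g ++ desc 0 j ++ [ p ]

data Good : ℕ → List ℕ → Set where
  []    : Good 0 []
  glued : ∀ {j r p g} → 1 ≤ p → p ≤ suc j → Good r g → Good (suc (j + r)) (glue j p g)

blocks : ℕ → List (List ℕ) → List (List ℕ)
blocks j gs = concatMap (λ p → map (glue j p) gs) (range (suc j))

-- goodFrom j m collects glue j′ p g for j ≤ j′ and g ∈ good r with j′ + r = j + m; counting j′ up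
-- rather than r down keeps the recursion structural.
good : ℕ → List (List ℕ)
goodFrom : ℕ → ℕ → List (List ℕ)
good zero    = [ [] ]
good (suc m) = goodFrom 0 m
goodFrom j zero    = blocks j (good zero)
goodFrom j (suc m) = blocks j (good (suc m)) ++ goodFrom (suc j) m

∈-blocks⁺ : ∀ j {p g gs} → 1 ≤ p → p ≤ suc j → g ∈ gs → glue j p g ∈ blocks j gs
∈-blocks⁺ j {p} {gs = gs} 1≤p p≤ g∈ =
  ∈-concatMap⁺ (λ p → map (glue j p) gs) (lose (∈-range⁺ 1≤p p≤) (∈-map⁺ (glue j p) g∈))

∈-blocks⁻ : ∀ j gs {f} → f ∈ blocks j gs → ∃₂ λ p g → 1 ≤ p × p ≤ suc j × g ∈ gs × f ≡ glue j p g
∈-blocks⁻ j gs f∈ with find (∈-concatMap⁻ (λ p → map (glue j p) gs) f∈)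
... | p , p∈ , f∈ₚ with ∈-map⁻ (glue j p) f∈ₚ
...   | g , g∈ , refl = p , g , proj₁ (∈-range⁻ p∈) , proj₂ (∈-range⁻ p∈) , g∈ , refl

∈-goodFrom⁺ : ∀ j m {j′ r p g} → j ≤ j′ → j′ + r ≡ j + m → 1 ≤ p → p ≤ suc j′ → g ∈ good r →
  glue j′ p g ∈ goodFrom j m
∈-goodFrom⁺ j m j≤j′ sum 1≤p p≤ g∈ with m≤n⇒m<n∨m≡n j≤j′
∈-goodFrom⁺ j zero    {j′} {r} _ sum _ _ _ | inj₁ j<j′ =
  contradiction (subst (j′ ≤_) (trans sum (+-identityʳ j)) (m≤m+n j′ r)) (<⇒≱ j<j′)
∈-goodFrom⁺ j (suc m) _ sum 1≤p p≤ g∈ | inj₁ j<j′ =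
  ∈-++⁺ʳ (blocks j (good (suc m))) (∈-goodFrom⁺ (suc j) m j<j′ (trans sum (+-suc j m)) 1≤p p≤ g∈)
∈-goodFrom⁺ j zero    {r = r} _ sum 1≤p p≤ g∈ | inj₂ refl with +-cancelˡ-≡ j r 0 sum
... | refl = ∈-blocks⁺ j 1≤p p≤ g∈
∈-goodFrom⁺ j (suc m) {r = r} _ sum 1≤p p≤ g∈ | inj₂ refl with +-cancelˡ-≡ j r (suc m) sum
... | refl = ∈-++⁺ˡ (∈-blocks⁺ j 1≤p p≤ g∈)

∈-good⁺ : ∀ {n f} → Good n f → f ∈ good n
∈-good⁺ []                            = here refl
∈-good⁺ (glued {j} {r} 1≤p p≤ good-g) = ∈-goodFrom⁺ 0 (j + r) z≤n refl 1≤p p≤ (∈-good⁺ good-g)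

-- Written without with and where: these would hide from the termination checker that the call
-- ∈-good⁻ (suc m) happens at the same m as the call it comes from.
∈-good⁻ : ∀ n {f} → f ∈ good n → Good n f
∈-goodFrom⁻ : ∀ j m {f} → f ∈ goodFrom j m →
  Good (suc (j + m)) f × ∃ λ j′ → j ≤ j′ × ∃₂ λ p g → f ≡ glue j′ p g
∈-good⁻ zero    (here refl) = []
∈-good⁻ (suc m) f∈          = proj₁ (∈-goodFrom⁻ 0 m f∈)
∈-goodFrom⁻ j zero {f} f∈ =
  let p , g , 1≤p , p≤ , g∈ , f≡ = ∈-blocks⁻ j (good zero) f∈
  in subst (Good (suc (j + 0))) (sym f≡) (glued 1≤p p≤ (∈-good⁻ zero g∈)) , j , ≤-refl , p , g , f≡
∈-goodFrom⁻ j (suc m) {f} f∈ =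
  [ (λ f∈ₗ → let p , g , 1≤p , p≤ , g∈ , f≡ = ∈-blocks⁻ j (good (suc m)) f∈ₗ
             in subst (Good (suc (j + suc m))) (sym f≡) (glued 1≤p p≤ (∈-good⁻ (suc m) g∈)) , j , ≤-refl , p , g , f≡)
  , (λ f∈ᵣ → let good-f , j′ , j<j′ , glued-f = ∈-goodFrom⁻ (suc j) m f∈ᵣ
             in subst (λ n → Good (suc n) f) (sym (+-suc j m)) good-f , j′ , <⇒≤ j<j′ , glued-f)
  ]′ (∈-++⁻ (blocks j (good (suc m))) f∈)

-- Good parking functions are valid

Entries : ℕ → List ℕ → Set
Entries n = All (λ v → 1 ≤ v × v ≤ n)

record Valid (n : ℕ) (f : List ℕ) : Set where
  field
    length≡   : length f ≡ n
    entries   : Entries n f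
    parking   : T (isParking n f)
    ρ         : List ℕ
    parks     : parkAll 1 f (emptyStreet n) ≡ map just ρ
    ρ≤n       : All (_≤ n) ρ
    avoids123 : Avoids ρ p123
    avoids132 : Avoids ρ p132

count-map-+ : ∀ k i g → count (_≤ᵇ k + i) (map (k +_) g) ≡ count (_≤ᵇ i) g
count-map-+ k i []      = refl
count-map-+ k i (v ∷ g) rewrite +-≤ᵇ-+ k v i with v ≤ᵇ i
... | true  = cong suc (count-map-+ k i g)
... | false = count-map-+ k i g

count-desc : ∀ i j → count (_≤ᵇ i) (desc 0 j) ≡ i ⊓ j
count-desc i zero    = sym (⊓-zeroʳ i)
count-desc i (suc j) with suc j ≤? i
... | yes j<i = begin
  count (_≤ᵇ i) (desc 0 (suc j)) ≡⟨ count-accept (_≤ᵇ i) (suc j) (desc 0 j) (≤⇒≤ᵇ j<i) ⟩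
  suc (count (_≤ᵇ i) (desc 0 j)) ≡⟨ cong suc (trans (count-desc i j) (m≥n⇒m⊓n≡n (<⇒≤ j<i))) ⟩
  suc j                          ≡⟨ sym (m≥n⇒m⊓n≡n j<i) ⟩
  i ⊓ suc j                      ∎
  where open ≡-Reasoning
... | no j≮i = begin
  count (_≤ᵇ i) (desc 0 (suc j)) ≡⟨ count-reject (_≤ᵇ i) (suc j) (desc 0 j) (j≮i ∘ ≤ᵇ⇒≤ _ _) ⟩
  count (_≤ᵇ i) (desc 0 j)       ≡⟨ trans (count-desc i j) (m≤n⇒m⊓n≡m (≤-pred (≰⇒> j≮i))) ⟩
  i                              ≡⟨ sym (m≤n⇒m⊓n≡m (≤-trans (≤-pred (≰⇒> j≮i)) (n≤1+n j))) ⟩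
  i ⊓ suc j                      ∎
  where open ≡-Reasoning

length-glue : ∀ j r p g → length g ≡ r → length (glue j p g) ≡ suc (j + r)
length-glue j r p g refl = begin
  length (map (suc j +_) g ++ desc 0 j ++ [ p ])        ≡⟨ length-++ (map (suc j +_) g) ⟩
  length (map (suc j +_) g) + length (desc 0 j ++ [ p ]) ≡⟨ cong₂ _+_ (length-map _ g)
                                                              (trans (length-++ (desc 0 j)) (cong (_+ 1) (length-desc 0 j))) ⟩
  length g + (j + 1)                                    ≡⟨ cong (length g +_) (+-comm j 1) ⟩
  length g + suc j                                      ≡⟨ +-suc (length g) j ⟩
  suc (length g + j)                                    ≡⟨ cong suc (+-comm (length g) j) ⟩
  suc (j + length g)                                    ∎
  where open ≡-Reasoning

entries-glue : ∀ j r p g → Entries r g → 1 ≤ p → p ≤ suc j → Entries (suc (j + r)) (glue j p g)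
entries-glue j r p g entries 1≤p p≤ = All.++⁺ shifted (All.++⁺ run ((1≤p , ≤-trans p≤ (s≤s (m≤m+n j r))) ∷ []))
  where
  shifted = All.map⁺ (All.map (λ {v} (1≤v , v≤r) → ≤-trans 1≤v (m≤n+m v (suc j)) , s≤s (+-monoʳ-≤ j v≤r)) entries)
  run = All.tabulate λ v∈ → ∈-desc⇒> 0 j v∈ , ≤-trans (∈-desc⇒≤ 0 j v∈) (≤-trans (m≤m+n j r) (n≤1+n _))

parkAll-glue : ∀ j r p g ρ → All (1 ≤_) g → length g ≡ r → parkAll 1 g (emptyStreet r) ≡ map just ρ → p ≤ suc j →
  parkAll 1 (glue j p g) (emptyStreet (suc (j + r))) ≡ map just (desc r j ++ suc (j + r) ∷ ρ)
parkAll-glue j r p g ρ g≥1 refl parks p≤ = begin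
  parkAll 1 (map (suc j +_) g ++ desc 0 j ++ [ p ]) (emptyStreet (suc (j + r)))
    ≡⟨ parkAll-++ 1 (map (suc j +_) g) (desc 0 j ++ [ p ]) _ ⟩
  parkAll (suc (length (map (suc j +_) g))) (desc 0 j ++ [ p ]) (parkAll 1 (map (suc j +_) g) (emptyStreet (suc (j + r))))
    ≡⟨ cong₂ (λ c st → parkAll (suc c) (desc 0 j ++ [ p ]) st) (length-map _ g)
             (cong (parkAll 1 (map (suc j +_) g)) (emptyStreet-+ (suc j) r)) ⟩
  parkAll (suc r) (desc 0 j ++ [ p ]) (parkAll 1 (map (suc j +_) g) (emptyStreet (suc j) ++ emptyStreet r))
    ≡⟨ cong (parkAll (suc r) (desc 0 j ++ [ p ])) (parkAll-behind-emptyStreet (suc j) 1 g (emptyStreet r) g≥1) ⟩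
  parkAll (suc r) (desc 0 j ++ [ p ]) (emptyStreet (suc j) ++ parkAll 1 g (emptyStreet r))
    ≡⟨ cong (λ st → parkAll (suc r) (desc 0 j ++ [ p ]) st) (trans (cong (emptyStreet (suc j) ++_) parks) (sym (emptyStreet-∷ʳ j _))) ⟩
  parkAll (suc r) (desc 0 j ++ [ p ]) (emptyStreet j ++ nothing ∷ map just ρ)
    ≡⟨ parkAll-++ (suc r) (desc 0 j) [ p ] _ ⟩
  parkCar (suc r + length (desc 0 j)) p 1 (parkAll (suc r) (desc 0 j) (emptyStreet j ++ nothing ∷ map just ρ))
    ≡⟨ cong₂ (λ c st → parkCar c p 1 st) (trans (cong (suc r +_) (length-desc 0 j)) (cong suc (+-comm r j)))
             (parkAll-desc j r (nothing ∷ map just ρ)) ⟩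
  parkCar (suc (j + r)) p 1 (map just (desc r j) ++ nothing ∷ map just ρ)
    ≡⟨ parkCar-first-free (suc (j + r)) p 1 (desc r j) (map just ρ) (subst (λ l → p ≤ suc l) (sym (length-desc r j)) p≤) ⟩
  map just (desc r j) ++ just (suc (j + r)) ∷ map just ρ
    ≡⟨ sym (map-++ just (desc r j) (suc (j + r) ∷ ρ)) ⟩
  map just (desc r j ++ suc (j + r) ∷ ρ) ∎
  where open ≡-Reasoning

count-glue : ∀ i j p g → count (_≤ᵇ i) (glue j p g) ≡ count (_≤ᵇ i) (map (suc j +_) g) + (i ⊓ j + count (_≤ᵇ i) [ p ])
count-glue i j p g = trans (count-++ (_≤ᵇ i) (map (suc j +_) g) _)
  (cong (count (_≤ᵇ i) (map (suc j +_) g) +_) (trans (count-++ (_≤ᵇ i) (desc 0 j) _) (cong (_+ _) (count-desc i j))))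

isParking-glue : ∀ j r p g → T (isParking r g) → p ≤ suc j → T (isParking (suc (j + r)) (glue j p g))
isParking-glue j r p g park p≤ = All.all⁻ _ (All.tabulate λ i∈ → ≤⇒≤ᵇ (enough (proj₂ (∈-range⁻ i∈))))
  where
  enough : ∀ {i} → i ≤ suc (j + r) → i ≤ count (_≤ᵇ i) (glue j p g)
  enough {i} i≤ with i ≤? j
  ... | yes i≤j = begin
    i                                                                    ≡⟨ sym (m≤n⇒m⊓n≡m i≤j) ⟩
    i ⊓ j                                                                ≤⟨ m≤m+n _ _ ⟩
    i ⊓ j + count (_≤ᵇ i) [ p ]                                          ≤⟨ m≤n+m _ (count (_≤ᵇ i) (map (suc j +_) g)) ⟩
    count (_≤ᵇ i) (map (suc j +_) g) + (i ⊓ j + count (_≤ᵇ i) [ p ])     ≡⟨ sym (count-glue i j p g) ⟩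
    count (_≤ᵇ i) (glue j p g)                                           ∎
    where open ≤-Reasoning
  ... | no i≰j = begin
    i                                                                    ≡⟨ i≡ ⟩
    k + (j + 1)                                                          ≤⟨ +-monoˡ-≤ (j + 1) (isParking⁻ r g park k≤r) ⟩
    count (_≤ᵇ k) g + (j + 1)                                            ≡⟨ cong₂ _+_ (sym shifted)
                                                                              (cong₂ _+_ (sym (m≥n⇒m⊓n≡n (<⇒≤ j<i))) (sym last)) ⟩
    count (_≤ᵇ i) (map (suc j +_) g) + (i ⊓ j + count (_≤ᵇ i) [ p ])     ≡⟨ sym (count-glue i j p g) ⟩
    count (_≤ᵇ i) (glue j p g)                                           ∎
    where
    open ≤-Reasoning
    j<i = ≰⇒> i≰j
    k = i ∸ suc j
    k≤r : k ≤ r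
    k≤r = subst (k ≤_) (m+n∸m≡n (suc j) r) (∸-monoˡ-≤ (suc j) i≤)
    i≡ : i ≡ k + (j + 1)
    i≡ = trans (sym (m+[n∸m]≡n j<i)) (trans (+-comm (suc j) k) (cong (k +_) (+-comm 1 j)))
    shifted : count (_≤ᵇ i) (map (suc j +_) g) ≡ count (_≤ᵇ k) g
    shifted = trans (cong (λ i′ → count (_≤ᵇ i′) (map (suc j +_) g)) (sym (m+[n∸m]≡n j<i))) (count-map-+ (suc j) k g)
    last : count (_≤ᵇ i) [ p ] ≡ 1
    last = count-accept (_≤ᵇ i) p [] (≤⇒≤ᵇ (≤-trans p≤ j<i))

Good⇒Valid : ∀ {n f} → Good n f → Valid n f
Good⇒Valid [] = record
  { length≡ = refl ; entries = [] ; parking = tt ; ρ = [] ; parks = refl ; ρ≤n = [] ; avoids123 = λ () ; avoids132 = λ () }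
Good⇒Valid (glued {j} {r} {p} {g} 1≤p p≤ good-g) = record
  { length≡   = length-glue j r p g length≡
  ; entries   = entries-glue j r p g entries 1≤p p≤
  ; parking   = isParking-glue j r p g parking p≤
  ; ρ         = desc r j ++ suc (j + r) ∷ ρ
  ; parks     = parkAll-glue j r p g ρ (All.map proj₁ entries) length≡ parks p≤
  ; ρ≤n       = All.++⁺ (All.tabulate λ {x} x∈ → m≤n⇒m≤1+n (subst (x ≤_) (+-comm r j) (∈-desc⇒≤ r j x∈)))
                        (≤-refl ∷ All.map (λ x≤r → m≤n⇒m≤1+n (≤-trans x≤r (m≤n+m r j))) ρ≤n)
  ; avoids123 = Avoids-desc minFirst-123 j r _ ρ (s≤s (≤-reflexive (+-comm r j))) ρ≤n avoids123
  ; avoids132 = Avoids-desc minFirst-132 j r _ ρ (s≤s (≤-reflexive (+-comm r j))) ρ≤n avoids132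
  }
  where open Valid (Good⇒Valid good-g)

-- Valid parking functions are good

map-just-split : ∀ (A : Street) {c B} (ρ : List ℕ) → A ++ just c ∷ B ≡ map just ρ →
  ∃₂ λ as bs → A ≡ map just as × B ≡ map just bs × ρ ≡ as ++ c ∷ bs
map-just-split []      (v ∷ ρ) e with ∷-injective e
... | refl , refl = [] , ρ , refl , refl , refl
map-just-split (_ ∷ A) (v ∷ ρ) e with ∷-injective e
... | refl , e′ with map-just-split A ρ e′
...   | as , bs , refl , refl , refl = v ∷ as , bs , refl , refl , refl

parkAll-∷ʳ⁻ : ∀ m h p ρ → length h ≡ m → parkAll 1 (h ++ [ p ]) (emptyStreet (suc m)) ≡ map just ρ →
  ∃₂ λ as bs → ρ ≡ as ++ suc m ∷ bs × parkAll 1 h (emptyStreet (suc m)) ≡ map just as ++ nothing ∷ map just bs ×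
               p ≤ suc (length as) × m ≡ length as + length bs
parkAll-∷ʳ⁻ m h p ρ refl parks with parkCar-shape (suc m) p 1 (parkAll 1 h (emptyStreet (suc m)))
... | inj₁ e = contradiction (≤-trans (≤-reflexive (sym length-ρ)) (begin
  length ρ                                                    ≡⟨ cong length (sym (catMaybes-map-just ρ)) ⟩
  length (catMaybes (map just ρ))                             ≡⟨ cong (length ∘ catMaybes) (trans (sym lastCar) e) ⟩
  length (catMaybes (parkAll 1 h (emptyStreet (suc m))))      ≤⟨ length-catMaybes-parkAll 1 h _ ⟩
  m + length (catMaybes (emptyStreet (suc m)))                ≡⟨ cong (λ cs → m + length cs) (catMaybes-emptyStreet (suc m)) ⟩
  m + 0                                                       ≡⟨ +-identityʳ m ⟩
  m                                                           ∎)) (<-irrefl refl)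
  where
  open ≤-Reasoning
  lastCar = trans (sym (parkAll-++ 1 h [ p ] _)) parks
  length-ρ : length ρ ≡ suc m
  length-ρ = trans (sym (length-map just ρ))
               (trans (cong length (sym parks)) (trans (length-parkAll 1 (h ++ [ p ]) _) (length-emptyStreet (suc m))))
... | inj₂ (A , B , e , e′ , p≤) with map-just-split A ρ (trans (sym e′) (trans (sym (parkAll-++ 1 h [ p ] _)) parks))
...   | as , bs , refl , refl , refl = as , bs , refl , e , subst (λ l → p ≤ suc l) (length-map just as) p≤ , suc-injective (begin
  suc m                                             ≡⟨ sym (trans (length-parkAll 1 h _) (length-emptyStreet (suc m))) ⟩
  length (parkAll 1 h (emptyStreet (suc m)))        ≡⟨ cong length e ⟩
  length (map just as ++ nothing ∷ map just bs)     ≡⟨ length-++ (map just as) ⟩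
  length (map just as) + suc (length (map just bs)) ≡⟨ cong₂ (λ a b → a + suc b) (length-map just as) (length-map just bs) ⟩
  length as + suc (length bs)                       ≡⟨ +-suc (length as) (length bs) ⟩
  suc (length as + length bs)                       ∎)
  where open ≡-Reasoning

-- The cars parked before the last one are exactly 1, …, j + r, so by avoider-shape the j of them in
-- front of it are the largest ones, in decreasing order.
desc-prefix⁻ : ∀ j r h as bs → length as ≡ j → length bs ≡ r → length h ≡ j + r →
  parkAll 1 h (emptyStreet (suc (j + r))) ≡ map just as ++ nothing ∷ map just bs →
  Avoids (as ++ suc (j + r) ∷ bs) p123 → Avoids (as ++ suc (j + r) ∷ bs) p132 →
  as ≡ desc r j × Avoids bs p123 × Avoids bs p132
desc-prefix⁻ j r h as bs refl refl len parks av123 av132 =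
  decreasing-top⇒desc j r as bs refl unique bounded covers decreasing above , avoids-bs
  where
  S = parkAll 1 h (emptyStreet (suc (j + r)))
  cars≡ : catMaybes S ≡ as ++ bs
  cars≡ = trans (cong catMaybes parks) (trans (catMaybes-map-just-++ as _) (cong (as ++_) (catMaybes-map-just bs)))
  no-cars : ∀ {P : ℕ → Set} → All P (catMaybes (emptyStreet (suc (j + r))))
  no-cars = subst (All _) (sym (catMaybes-emptyStreet (suc (j + r)))) []
  unique : Unique (as ++ bs)
  unique = subst Unique cars≡ (Unique-catMaybes-parkAll 1 h _ (subst Unique (sym (catMaybes-emptyStreet (suc (j + r)))) []) no-cars)
  below : All (_< suc (j + r)) (as ++ bs)
  below = subst₂ (λ cs l → All (_< suc l) cs) cars≡ len (catMaybes-parkAll-< 1 h _ no-cars)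
  bounded : All (_≤ r + j) (as ++ bs)
  bounded = All.map (λ {x} x< → subst (x ≤_) (+-comm j r) (≤-pred x<)) below
  parked : AllParked 1 h (emptyStreet (suc (j + r)))
  parked = begin
    length (catMaybes S)                                        ≡⟨ cong length cars≡ ⟩
    length (as ++ bs)                                           ≡⟨ trans (length-++ as) (sym len) ⟩
    length h                                                    ≡⟨ sym (+-identityʳ _) ⟩
    length h + 0                                                ≡⟨ cong (λ cs → length h + length cs)
                                                                        (sym (catMaybes-emptyStreet (suc (j + r)))) ⟩
    length h + length (catMaybes (emptyStreet (suc (j + r))))   ∎
    where open ≡-Reasoning
  covers : ∀ {k} → 1 ≤ k → k ≤ r + j → k ∈ as ++ bs
  covers {k} 1≤k k≤ = subst (k ∈_) cars≡
    (∈-catMaybes-parkAll 1 h _ parked 1≤k (s≤s (subst (k ≤_) (trans (+-comm r j) (sym len)) k≤)))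
  shape = avoider-shape as (suc (j + r)) bs av123 av132 unique below
  decreasing = proj₁ shape
  above = proj₁ (proj₂ shape)
  avoids-bs = proj₂ (proj₂ shape)

-- Cars 1..r are smaller than the entries r+1..r+j that end up in spots 1..j, so after cars 1..r
-- these spots are still free, and cars r+1..r+j fill them from the right.
parkAll-glue⁻ : ∀ j r h bs → All (1 ≤_) h → length h ≡ j + r →
  parkAll 1 h (emptyStreet (suc (j + r))) ≡ map just (desc r j) ++ nothing ∷ map just bs →
  ∃ λ g → h ≡ map (suc j +_) g ++ desc 0 j × All (1 ≤_) g × parkAll 1 g (emptyStreet r) ≡ map just bs
parkAll-glue⁻ j r h bs h≥1 len parks = g , trans (sym split) (cong₂ _++_ h₁≡ h₂≡) , g≥1 , g-parks
  where
  h₁ = take r h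
  h₂ = drop r h
  split : h₁ ++ h₂ ≡ h
  split = take++drop≡id r h
  h₁≥1 = All.++⁻ˡ h₁ (subst (All (1 ≤_)) (sym split) h≥1)
  h₂≥1 = All.++⁻ʳ h₁ (subst (All (1 ≤_)) (sym split) h≥1)
  len₁ : length h₁ ≡ r
  len₁ = trans (length-take r h) (m≤n⇒m⊓n≡m (subst (r ≤_) (sym len) (m≤n+m r j)))
  len₂ : length h₂ ≡ j
  len₂ = trans (length-drop r h) (trans (cong (_∸ r) len) (m+n∸n≡m j r))
  S₁ = parkAll 1 h₁ (emptyStreet (suc (j + r)))
  final : parkAll (suc r) h₂ S₁ ≡ map just (desc r j) ++ nothing ∷ map just bs
  final = trans (cong (λ c → parkAll (suc c) h₂ S₁) (sym len₁))
                (trans (sym (parkAll-++ 1 h₁ h₂ _)) (trans (cong (λ h′ → parkAll 1 h′ _) split) parks))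
  cars₁≤r : All (_≤ r) (catMaybes S₁)
  cars₁≤r = All.map (λ {x} x< → subst (x ≤_) len₁ (≤-pred x<))
              (catMaybes-parkAll-< 1 h₁ _ (subst (All (_< 1)) (sym (catMaybes-emptyStreet (suc (j + r)))) []))
  front : ∃ λ B₁ → S₁ ≡ emptyStreet j ++ nothing ∷ B₁
  front = subst (λ l → ∃ λ B₁ → S₁ ≡ emptyStreet l ++ nothing ∷ B₁) (length-desc r j)
            (⊑-above-free (desc r j) (subst (S₁ ⊑_) final (⊑-parkAll (suc r) h₂ S₁)) (All.tabulate (∈-desc⇒> r j)) cars₁≤r)
  B₁ = proj₁ front
  run = parkAll-desc⁻ j r h₂ (nothing ∷ B₁) (nothing ∷ map just bs) h₂≥1 len₂
          (trans (cong (parkAll (suc r) h₂) (sym (proj₂ front))) final)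
  h₂≡ : h₂ ≡ desc 0 j
  h₂≡ = proj₁ run
  S₁≡ : S₁ ≡ emptyStreet (suc j) ++ map just bs
  S₁≡ = trans (proj₂ front) (trans (cong (emptyStreet j ++_) (sym (proj₂ run))) (emptyStreet-∷ʳ j (map just bs)))
  behind = parkAll-behind-emptyStreet⁻ (suc j) 1 h₁ (emptyStreet r) (map just bs) h₁≥1
             (trans (cong (parkAll 1 h₁) (sym (emptyStreet-+ (suc j) r))) S₁≡)
  g = proj₁ behind
  h₁≡ = proj₁ (proj₂ behind)
  g≥1 = proj₁ (proj₂ (proj₂ behind))
  g-parks = proj₂ (proj₂ (proj₂ behind))

glue⁻ : ∀ j r h p as bs → length as ≡ j → length bs ≡ r → length h ≡ j + r → Entries (suc (j + r)) (h ++ [ p ]) →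
  parkAll 1 h (emptyStreet (suc (j + r))) ≡ map just as ++ nothing ∷ map just bs →
  Avoids (as ++ suc (j + r) ∷ bs) p123 → Avoids (as ++ suc (j + r) ∷ bs) p132 →
  ∃ λ g → h ++ [ p ] ≡ glue j p g × length g ≡ r × Entries r g × parkAll 1 g (emptyStreet r) ≡ map just bs ×
          Avoids bs p123 × Avoids bs p132
glue⁻ j r h p as bs len-as len-bs len entries parks av123 av132 =
  g , f≡ , len-g , entries-g , g-parks , av123′ , av132′
  where
  prefix = desc-prefix⁻ j r h as bs len-as len-bs len parks av123 av132
  av123′ = proj₁ (proj₂ prefix)
  av132′ = proj₂ (proj₂ prefix)
  entries-h = All.++⁻ˡ h entries
  layers = parkAll-glue⁻ j r h bs (All.map proj₁ entries-h) len
             (trans parks (cong (λ xs → map just xs ++ nothing ∷ map just bs) (proj₁ prefix)))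
  g = proj₁ layers
  h≡ : h ≡ map (suc j +_) g ++ desc 0 j
  h≡ = proj₁ (proj₂ layers)
  g-parks = proj₂ (proj₂ (proj₂ layers))
  f≡ : h ++ [ p ] ≡ glue j p g
  f≡ = trans (cong (_++ [ p ]) h≡) (++-assoc (map (suc j +_) g) (desc 0 j) [ p ])
  len-g : length g ≡ r
  len-g = +-cancelʳ-≡ j (length g) r (begin
    length g + j                                  ≡⟨ cong₂ _+_ (sym (length-map (suc j +_) g)) (sym (length-desc 0 j)) ⟩
    length (map (suc j +_) g) + length (desc 0 j) ≡⟨ sym (length-++ (map (suc j +_) g)) ⟩
    length (map (suc j +_) g ++ desc 0 j)         ≡⟨ cong length (sym h≡) ⟩
    length h                                      ≡⟨ trans len (+-comm j r) ⟩
    r + j                                         ∎)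
    where open ≡-Reasoning
  entries-g : Entries r g
  entries-g = All.tabulate λ {v} v∈ →
    All.lookup (proj₁ (proj₂ (proj₂ layers))) v∈ ,
    +-cancelˡ-≤ (suc j) v r (proj₂ (All.lookup (All.map⁻ (All.++⁻ˡ (map (suc j +_) g) (subst (Entries _) h≡ entries-h))) v∈))

Good-complete : ∀ n f ρ → length f ≡ n → Entries n f → parkAll 1 f (emptyStreet n) ≡ map just ρ →
  Avoids ρ p123 → Avoids ρ p132 → Good n f
Good-complete = <-rec Complete step
  where
  Complete : ℕ → Set
  Complete n = ∀ f ρ → length f ≡ n → Entries n f → parkAll 1 f (emptyStreet n) ≡ map just ρ →
    Avoids ρ p123 → Avoids ρ p132 → Good n f
  step : ∀ n → (∀ {r} → r < n → Complete r) → Complete n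
  step zero    _   [] _ _ _ _ _ _ = []
  step (suc m) rec f ρ len entries parks av123 av132 with initLast f
  ... | h ∷ʳ′ p with parkAll-∷ʳ⁻ m h p ρ (suc-injective (trans (sym (length-∷ʳ h p)) len)) parks
  ...   | as , bs , refl , S≡ , p≤ , refl =
    let g , f≡ , len-g , entries-g , g-parks , av123′ , av132′ =
          glue⁻ (length as) (length bs) h p as bs refl refl (suc-injective (trans (sym (length-∷ʳ h p)) len))
                entries S≡ av123 av132
    in subst (Good _) (sym f≡)
         (glued (proj₁ (All.lookup entries (∈-++⁺ʳ h (here refl)))) p≤
                (rec (s≤s (m≤n+m _ _)) g bs len-g entries-g g-parks av123′ av132′))

Unique⇒length≤ : ∀ {A : Set} (xs ys : List A) → Unique xs → (∀ {x} → x ∈ xs → x ∈ ys) → length xs ≤ length ys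
Unique⇒length≤ []       ys _           _  = z≤n
Unique⇒length≤ (x ∷ xs) ys (x∉ ∷ u) xs⊆ with ∈-∃++ (xs⊆ (here refl))
... | ys₁ , ys₂ , refl = ≤-trans (s≤s (Unique⇒length≤ xs (ys₁ ++ ys₂) u xs⊆′)) (≤-reflexive (sym (length-++-sucʳ ys₁ x ys₂)))
  where
  xs⊆′ : ∀ {y} → y ∈ xs → y ∈ ys₁ ++ ys₂
  xs⊆′ y∈ with ∈-++⁻ ys₁ (xs⊆ (there y∈))
  ... | inj₁ y∈₁         = ∈-++⁺ˡ y∈₁
  ... | inj₂ (here refl) = contradiction refl (All.lookup x∉ y∈)
  ... | inj₂ (there y∈₂) = ∈-++⁺ʳ ys₁ y∈₂

count≡length : ∀ {A : Set} (P : A → Bool) xs ys → Unique xs → Unique ys →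
  (∀ {y} → y ∈ ys → y ∈ xs × T (P y)) → (∀ {x} → x ∈ xs → T (P x) → x ∈ ys) → count P xs ≡ length ys
count≡length P xs ys uxs uys sound complete = ≤-antisym
  (Unique⇒length≤ (filterᵇ P xs) ys (Unique.filter⁺ (T? ∘ P) uxs) (λ x∈ → uncurry complete (∈-filter⁻ (T? ∘ P) x∈)))
  (Unique⇒length≤ ys (filterᵇ P xs) uys (λ y∈ → uncurry (∈-filter⁺ (T? ∘ P)) (sound y∈)))

∈-allFns⁺ : ∀ k n {f} → length f ≡ k → Entries n f → f ∈ allFns k n
∈-allFns⁺ zero    n {[]}    refl []                     = here refl
∈-allFns⁺ (suc k) n {v ∷ f} len  ((1≤v , v≤n) ∷ entries) =
  ∈-concatMap⁺ (λ v → map (v ∷_) (allFns k n))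
    (lose (∈-range⁺ 1≤v v≤n) (∈-map⁺ (v ∷_) (∈-allFns⁺ k n (suc-injective len) entries)))

∈-allFns⁻ : ∀ k n {f} → f ∈ allFns k n → length f ≡ k × Entries n f
∈-allFns⁻ zero    n (here refl) = refl , []
∈-allFns⁻ (suc k) n f∈ with find (∈-concatMap⁻ (λ v → map (v ∷_) (allFns k n)) {xs = range n} f∈)
... | v , v∈ , f∈ᵥ with ∈-map⁻ (v ∷_) f∈ᵥ
...   | f , f∈′ , refl = cong suc (proj₁ (∈-allFns⁻ k n f∈′)) , ∈-range⁻ v∈ ∷ proj₂ (∈-allFns⁻ k n f∈′)

Unique-range : ∀ n → Unique (range n)
Unique-range n = Unique.map⁺ suc-injective (Unique.upTo⁺ n)

Unique-allFns : ∀ k n → Unique (allFns k n)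
Unique-allFns zero    n = [] ∷ []
Unique-allFns (suc k) n = Unique.concat⁺
  (All.map⁺ (All.tabulate λ _ → Unique.map⁺ (proj₂ ∘ ∷-injective) (Unique-allFns k n)))
  (AllPairs.map⁺ (AllPairs.map disjoint (Unique-range n)))
  where
  disjoint : ∀ {v w} → v ≢ w → Disjoint (map (v ∷_) (allFns k n)) (map (w ∷_) (allFns k n))
  disjoint v≢w (f∈ᵥ , f∈w) with ∈-map⁻ _ f∈ᵥ | ∈-map⁻ _ f∈w
  ... | _ , _ , refl | _ , _ , e = v≢w (proj₁ (∷-injective e))

glue-∷ʳ : ∀ j p g → glue j p g ≡ (map (suc j +_) g ++ desc 0 j) ++ [ p ]
glue-∷ʳ j p g = sym (++-assoc (map (suc j +_) g) (desc 0 j) [ p ])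

glue-injective : ∀ j {p p′ g g′} → glue j p g ≡ glue j p′ g′ → p ≡ p′ × g ≡ g′
glue-injective j {p} {p′} {g} {g′} e with ∷ʳ-injective _ _ (trans (sym (glue-∷ʳ j p g)) (trans e (glue-∷ʳ j p′ g′)))
... | init≡ , p≡ = p≡ , map-injective (+-cancelˡ-≡ (suc j) _ _) (++-cancelʳ (desc 0 j) _ _ init≡)

-- In glue j′ the entry suc j sits where glue j has an entry of the shifted g, all of which exceed suc j.
glue-≢ : ∀ {j j′ p p′ g g′} → j < j′ → All (1 ≤_) g → glue j p g ≢ glue j′ p′ g′
glue-≢ {j} {j′} {p} {p′} {g} {g′} j<j′ g≥1 e = contradiction (subst (1 ≤_) v≡0 (All.lookup g≥1 v∈)) λ ()
  where
  t = j′ ∸ j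
  j′≡ : j′ ≡ t + j
  j′≡ = sym (m∸n+n≡m (<⇒≤ j<j′))
  inits : map (suc j +_) g ++ desc 0 j ≡ (map (suc j′ +_) g′ ++ desc j t) ++ desc 0 j
  inits = trans (proj₁ (∷ʳ-injective _ _ (trans (sym (glue-∷ʳ j p g)) (trans e (glue-∷ʳ j′ p′ g′)))))
                (trans (cong (λ j″ → map (suc j′ +_) g′ ++ desc 0 j″) j′≡)
                       (trans (cong (map (suc j′ +_) g′ ++_) (desc-+ j t)) (sym (++-assoc (map (suc j′ +_) g′) _ _))))
  j+1∈ : suc j ∈ map (suc j +_) g
  j+1∈ = subst (suc j ∈_) (sym (++-cancelʳ (desc 0 j) _ _ inits))
           (∈-++⁺ʳ (map (suc j′ +_) g′) (∈-desc⁺ j t ≤-refl (subst (suc j ≤_) (+-comm t j) (+-monoˡ-≤ j (m<n⇒0<n∸m j<j′)))))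
  v = proj₁ (∈-map⁻ (suc j +_) j+1∈)
  v∈ = proj₁ (proj₂ (∈-map⁻ (suc j +_) j+1∈))
  v≡0 : v ≡ 0
  v≡0 = +-cancelˡ-≡ (suc j) v 0 (trans (sym (proj₂ (proj₂ (∈-map⁻ (suc j +_) j+1∈)))) (sym (+-identityʳ (suc j))))

Unique-blocks : ∀ j gs → Unique gs → Unique (blocks j gs)
Unique-blocks j gs u = Unique.concat⁺
  (All.map⁺ (All.tabulate λ {p} _ → Unique.map⁺ (λ {g} {g′} e → proj₂ (glue-injective j {p} {p} {g} {g′} e)) u))
  (AllPairs.map⁺ (AllPairs.map disjoint (Unique-range (suc j))))
  where
  disjoint : ∀ {p p′} → p ≢ p′ → Disjoint (map (glue j p) gs) (map (glue j p′) gs)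
  disjoint p≢p′ (f∈ , f∈′) with ∈-map⁻ _ f∈ | ∈-map⁻ _ f∈′
  ... | g , _ , refl | g′ , _ , e = p≢p′ (proj₁ (glue-injective j {g = g} {g′} e))

Unique-good : ∀ n → Unique (good n)
Unique-goodFrom : ∀ j m → Unique (goodFrom j m)
Unique-good zero    = [] ∷ []
Unique-good (suc m) = Unique-goodFrom 0 m
Unique-goodFrom j zero    = Unique-blocks j (good zero) (Unique-good zero)
Unique-goodFrom j (suc m) = Unique.++⁺ (Unique-blocks j (good (suc m)) (Unique-good (suc m))) (Unique-goodFrom (suc j) m) disjoint
  where
  disjoint : Disjoint (blocks j (good (suc m))) (goodFrom (suc j) m)
  disjoint (f∈ , f∈′) with ∈-blocks⁻ j (good (suc m)) f∈ | proj₂ (∈-goodFrom⁻ (suc j) m f∈′)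
  ... | p , g , _ , _ , g∈ , f≡ | j′ , j<j′ , p′ , g′ , f≡′ =
    glue-≢ {p′ = p′} {g′ = g′} j<j′ (All.map proj₁ (Valid.entries (Good⇒Valid (∈-good⁻ (suc m) g∈)))) (trans (sym f≡) f≡′)

parkingPerm-map-just : ∀ n f ρ → parkAll 1 f (emptyStreet n) ≡ map just ρ → parkingPerm n f ≡ ρ
parkingPerm-map-just n f ρ parks = trans (cong (map fromSpot) parks) (trans (sym (map-∘ ρ)) (map-id ρ))

avoids-both⁺ : ∀ π → Avoids π p123 → Avoids π p132 → T (all (avoids π) (p123 ∷ p132 ∷ []))
avoids-both⁺ π av123 av132 =
  All.all⁻ (avoids π) {xs = p123 ∷ p132 ∷ []} (T-not⁺ (contains π p123) av123 ∷ T-not⁺ (contains π p132) av132 ∷ [])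

avoids-both⁻ : ∀ π → T (all (avoids π) (p123 ∷ p132 ∷ [])) → Avoids π p123 × Avoids π p132
avoids-both⁻ π av with All.all⁺ (avoids π) (p123 ∷ p132 ∷ []) av
... | av123 ∷ av132 ∷ [] = T-not⁻ (contains π p123) av123 , T-not⁻ (contains π p132) av132

pk≡length-good : ∀ n → pk n (p123 ∷ p132 ∷ []) ≡ length (good n)
pk≡length-good n = count≡length _ (allFns n n) (good n) (Unique-allFns n n) (Unique-good n) sound complete
  where
  Selected : List ℕ → Set
  Selected f = T (isParking n f ∧ all (avoids (parkingPerm n f)) (p123 ∷ p132 ∷ []))
  sound : ∀ {f} → f ∈ good n → f ∈ allFns n n × Selected f
  sound {f} f∈ = ∈-allFns⁺ n n length≡ entries ,
    Equivalence.from T-∧ (parking , subst (λ π → T (all (avoids π) (p123 ∷ p132 ∷ []))) (sym (parkingPerm-map-just n f ρ parks))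
                                          (avoids-both⁺ ρ avoids123 avoids132))
    where open Valid (Good⇒Valid (∈-good⁻ n f∈))
  complete : ∀ {f} → f ∈ allFns n n → Selected f → f ∈ good n
  complete {f} f∈ selected with Equivalence.to T-∧ selected
  ... | parking , avoiding with isParking⇒parks n f parking
  ...   | ρ , parks
    with avoids-both⁻ ρ (subst (λ π → T (all (avoids π) (p123 ∷ p132 ∷ []))) (parkingPerm-map-just n f ρ parks) avoiding)
  ...     | av123 , av132 =
    ∈-good⁺ (Good-complete n f ρ (proj₁ (∈-allFns⁻ n n f∈)) (proj₂ (∈-allFns⁻ n n f∈)) parks av123 av132)

-- The closed form

length-range : ∀ n → length (range n) ≡ n
length-range n = trans (length-map suc (upTo n)) (length-upTo n)

length-blocks : ∀ j gs → length (blocks j gs) ≡ suc j * length gs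
length-blocks j gs = trans (go (range (suc j))) (cong (_* length gs) (length-range (suc j)))
  where
  go : ∀ ps → length (concatMap (λ p → map (glue j p) gs) ps) ≡ length ps * length gs
  go []       = refl
  go (p ∷ ps) = trans (length-++ (map (glue j p) gs)) (cong₂ _+_ (length-map (glue j p) gs) (go ps))

partialSum : ℕ → ℕ
partialSum zero    = length (good zero)
partialSum (suc m) = partialSum m + length (good (suc m))

length-goodFrom-suc : ∀ j m → length (goodFrom (suc j) m) ≡ length (goodFrom j m) + partialSum m
length-goodFrom-suc j zero = begin
  length (blocks (suc j) (good zero))   ≡⟨ length-blocks (suc j) (good zero) ⟩
  suc (suc j) * 1                       ≡⟨ solve 1 (λ j → (con 2 :+ j) :* con 1 := (con 1 :+ j) :* con 1 :+ con 1) refl j ⟩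
  suc j * 1 + 1                         ≡⟨ cong (_+ 1) (sym (length-blocks j (good zero))) ⟩
  length (blocks j (good zero)) + 1     ∎
  where
  open ≡-Reasoning
  open +-*-Solver
length-goodFrom-suc j (suc m) = begin
  length (blocks (suc j) (good (suc m)) ++ goodFrom (suc (suc j)) m)
    ≡⟨ length-++ (blocks (suc j) (good (suc m))) ⟩
  length (blocks (suc j) (good (suc m))) + length (goodFrom (suc (suc j)) m)
    ≡⟨ cong₂ _+_ (length-blocks (suc j) (good (suc m))) (length-goodFrom-suc (suc j) m) ⟩
  suc (suc j) * a + (A + S)
    ≡⟨ solve 4 (λ j a A S → (con 2 :+ j) :* a :+ (A :+ S) := ((con 1 :+ j) :* a :+ A) :+ (S :+ a)) refl j a A S ⟩
  (suc j * a + A) + (S + a)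
    ≡⟨ cong (λ l → (l + A) + (S + a)) (sym (length-blocks j (good (suc m)))) ⟩
  (length (blocks j (good (suc m))) + A) + (S + a)
    ≡⟨ cong (_+ (S + a)) (sym (length-++ (blocks j (good (suc m))))) ⟩
  length (blocks j (good (suc m)) ++ goodFrom (suc j) m) + partialSum (suc m) ∎
  where
  open ≡-Reasoning
  open +-*-Solver
  a = length (good (suc m))
  A = length (goodFrom (suc j) m)
  S = partialSum m

length-good-suc-suc : ∀ m → length (good (suc (suc m))) ≡ length (good (suc m)) + length (good (suc m)) + partialSum m
length-good-suc-suc m = begin
  length (blocks 0 (good (suc m)) ++ goodFrom 1 m)           ≡⟨ length-++ (blocks 0 (good (suc m))) ⟩
  length (blocks 0 (good (suc m))) + length (goodFrom 1 m)   ≡⟨ cong₂ _+_ (trans (length-blocks 0 (good (suc m))) (*-identityˡ _))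
                                                                          (length-goodFrom-suc 0 m) ⟩
  a + (a + partialSum m)                                     ≡⟨ sym (+-assoc a a _) ⟩
  a + a + partialSum m                                       ∎
  where
  open ≡-Reasoning
  a = length (good (suc m))

ι : ℕ → ℚ
ι k = ℤ.+ k / 1

ι≡mkℚ : ∀ k → ι k ≡ mkℚ (ℤ.+ k) 0 (λ {d} d∣ → ∣1⇒≡1 (proj₂ d∣))
ι≡mkℚ k = ℚₚ.normalize-coprime (λ {d} d∣ → ∣1⇒≡1 (proj₂ d∣))

ι-+ : ∀ a b → ι (a + b) ≡ ι a +ℚ ι b
ι-+ zero    b       = sym (ℚₚ.+-identityˡ (ι b))
ι-+ (suc a) zero    = trans (cong ι (+-identityʳ (suc a))) (sym (ℚₚ.+-identityʳ (ι (suc a))))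
ι-+ (suc a) (suc b) rewrite ι≡mkℚ (suc a) | ι≡mkℚ (suc b) =
  cong (λ k → ℤ.+ k / 1) (cong₂ (λ u v → suc u + suc v) (sym (*-identityʳ a)) (sym (*-identityʳ b)))

-- With a = |good (m + 1)| and S = |good 0| + … + |good m|, the recurrence a′ = 2a + S, S′ = S + a is
-- multiplication by φ² = (3 + √5)/2 of (a/2 + S) + (a/2)√5.
φ²-pow : ∀ m → φ² ^5 suc m ≡ (½ *ℚ ι (length (good (suc m))) +ℚ ι (partialSum m) , ½ *ℚ ι (length (good (suc m))))
φ²-pow zero    = refl
φ²-pow (suc m) = trans (cong (φ² ⊗_) (φ²-pow m)) (cong₂ _,_
  (trans (solve 2 (λ a s → (con (ℤ.+ 3 / 2) :* ((con ½ :* a) :+ s)) :+ (con (ℤ.+ 5 / 1) :* (con ½ :* (con ½ :* a)))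
                       := (con ½ :* ((a :+ a) :+ s)) :+ (s :+ a)) refl (ι a) (ι S))
         (sym (cong₂ (λ a′ s′ → ½ *ℚ a′ +ℚ s′) ι-a′ (ι-+ S a))))
  (trans (solve 2 (λ a s → (con (ℤ.+ 3 / 2) :* (con ½ :* a)) :+ (con ½ :* ((con ½ :* a) :+ s))
                       := con ½ :* ((a :+ a) :+ s)) refl (ι a) (ι S))
         (sym (cong (½ *ℚ_) ι-a′))))
  where
  open ℚ-Solver.+-*-Solver
  a = length (good (suc m))
  S = partialSum m
  ι-a′ : ι (length (good (suc (suc m)))) ≡ (ι a +ℚ ι a) +ℚ ι S
  ι-a′ = trans (cong ι (length-good-suc-suc m)) (trans (ι-+ (a + a) S) (cong (_+ℚ ι S) (ι-+ a a)))

conj : Q5 → Q5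
conj (a , b) = (a , 0ℚ -ℚ b)

conj-⊗ : ∀ u v → conj u ⊗ conj v ≡ conj (u ⊗ v)
conj-⊗ (a , b) (c , d) = cong₂ _,_
  (solve 4 (λ a b c d → (a :* c) :+ (con (ℤ.+ 5 / 1) :* ((con 0ℚ :- b) :* (con 0ℚ :- d)))
                      := (a :* c) :+ (con (ℤ.+ 5 / 1) :* (b :* d))) refl a b c d)
  (solve 4 (λ a b c d → (a :* (con 0ℚ :- d)) :+ ((con 0ℚ :- b) :* c) := con 0ℚ :- ((a :* d) :+ (b :* c))) refl a b c d)
  where open ℚ-Solver.+-*-Solver

ψ²-pow : ∀ n → ψ² ^5 n ≡ conj (φ² ^5 n)
ψ²-pow zero    = refl
ψ²-pow (suc n) = trans (cong (ψ² ⊗_) (ψ²-pow n)) (conj-⊗ φ² (φ² ^5 n))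

invSqrt5-conj : ∀ x y → (invSqrt5 ⊗ (x , y)) ⊖ (invSqrt5 ⊗ conj (x , y)) ≡ (y +ℚ y , 0ℚ)
invSqrt5-conj x y = cong₂ _,_
  (solve 2 (λ x y → ((con 0ℚ :* x) :+ (con (ℤ.+ 5 / 1) :* (con (ℤ.+ 1 / 5) :* y)))
                    :- ((con 0ℚ :* x) :+ (con (ℤ.+ 5 / 1) :* (con (ℤ.+ 1 / 5) :* (con 0ℚ :- y)))) := y :+ y) refl x y)
  (solve 2 (λ x y → ((con 0ℚ :* y) :+ (con (ℤ.+ 1 / 5) :* x))
                    :- ((con 0ℚ :* (con 0ℚ :- y)) :+ (con (ℤ.+ 1 / 5) :* x)) := con 0ℚ) refl x y)
  where open ℚ-Solver.+-*-Solver

half+half : ∀ w → ½ *ℚ w +ℚ ½ *ℚ w ≡ w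
half+half = solve 1 (λ w → (con ½ :* w) :+ (con ½ :* w) := w) refl
  where open ℚ-Solver.+-*-Solver

length-good≡binet : ∀ m → embedℕ (length (good (suc m))) ≡ (invSqrt5 ⊗ (φ² ^5 suc m)) ⊖ (invSqrt5 ⊗ (ψ² ^5 suc m))
length-good≡binet m = sym (begin
  (invSqrt5 ⊗ (φ² ^5 suc m)) ⊖ (invSqrt5 ⊗ (ψ² ^5 suc m))
    ≡⟨ cong (λ z → (invSqrt5 ⊗ (φ² ^5 suc m)) ⊖ (invSqrt5 ⊗ z)) (ψ²-pow (suc m)) ⟩
  (invSqrt5 ⊗ (φ² ^5 suc m)) ⊖ (invSqrt5 ⊗ conj (φ² ^5 suc m))
    ≡⟨ cong (λ z → (invSqrt5 ⊗ z) ⊖ (invSqrt5 ⊗ conj z)) (φ²-pow m) ⟩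
  (invSqrt5 ⊗ (x , y)) ⊖ (invSqrt5 ⊗ conj (x , y))
    ≡⟨ invSqrt5-conj x y ⟩
  (y +ℚ y , 0ℚ)
    ≡⟨ cong (_, 0ℚ) (half+half (ι (length (good (suc m))))) ⟩
  embedℕ (length (good (suc m))) ∎)
  where
  open ≡-Reasoning
  x = ½ *ℚ ι (length (good (suc m))) +ℚ ι (partialSum m)
  y = ½ *ℚ ι (length (good (suc m)))

mainTheorem10 : (n : ℕ) → n ≥ 1 →
    embedℕ (pk n (p123 ∷ p132 ∷ [])) ≡ (invSqrt5 ⊗ (φ² ^5 n)) ⊖ (invSqrt5 ⊗ (ψ² ^5 n))
mainTheorem10 (suc m) _ = begin
  embedℕ (pk (suc m) (p123 ∷ p132 ∷ []))                   ≡⟨ cong embedℕ (pk≡length-good (suc m)) ⟩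
  embedℕ (length (good (suc m)))                           ≡⟨ length-good≡binet m ⟩
  (invSqrt5 ⊗ (φ² ^5 suc m)) ⊖ (invSqrt5 ⊗ (ψ² ^5 suc m))  ∎
  where open ≡-Reasoning
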